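{- Let $d$ be a positive integer and let $f_d(x)$ be the monic polynomial of degree $d$ with integer coefficients such that $\alpha_p^d=f_d(p)$ for all sufficiently large primes $p$. For $0\leq i\leq d-1$, the coefficient of $x^i$ in $f_d(x)$ equals $\sum_{j=1}^{2^d-1}(-1)^j m(j,i)$, where $m(j,i)$ is the number of subsets of $j$ columns of $H_d$ that span a $(d-i)$-dimensional subspace of $\mathbb{F}_p^d$ (for $p$ a sufficiently large prime).
   Context: For a positive integer $n$, a vector $(v_1,\dots,v_d)\in\mathbb{Z}_n^d$ is zero-sum-free if no non-empty subset of its components sums to $0$ in $\mathbb{Z}_n$; $\alpha_n^d$ is the number of such vectors. Such a polynomial $f_d$ exists and is unique (two polynomials agreeing at infinitely many points coincide). $H_d$ is the $d\times(2^d-1)$ matrix whose columns are all the non-zero vectors with entries in $\{0,1\}$, viewed in $\mathbb{F}_p^d$, where $\mathbb{F}_p$ is the field with $p$ elements. -}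

module Defs where

open import Data.Bool using (Bool; true; false; if_then_else_)
open import Data.Nat using (ℕ; zero; suc; _+_; _*_; _∸_; _^_; _⊔_; _%_; _/_)
open import Data.Nat.Divisibility using (_∣_; _∣?_)
open import Data.Fin using (Fin; toℕ)
import Data.Fin.Properties as FinP
open import Data.Fin.Subset using (Subset; Nonempty; _∉_; _⊆_; ∣_∣)
open import Data.Fin.Subset.Properties using (nonempty?; _⊆?_; _∈?_)
open import Data.Vec using (Vec; []; _∷_; lookup)
open import Data.List using (List; []; _∷_; [_]; map; filter; length; foldr; concatMap; allFin; upTo)
open import Data.Integer as ℤ using (ℤ; +_; -1ℤ)
open import Data.Product using (_×_; _,_)
open import Relation.Nullary using (¬_; Dec; yes; no)
open import Relation.Nullary.Decidable using (map′; ¬?; _×-dec_; _→-dec_)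
open import Relation.Unary using (Decidable)
open import Relation.Binary.PropositionalEquality using (_≡_)
import Data.Nat.Properties as ℕP

allVecs : ∀ {A : Set} → List A → (n : ℕ) → List (Vec A n)
allVecs xs zero    = [ [] ]
allVecs xs (suc n) = concatMap (λ x → map (x ∷_) (allVecs xs n)) xs

allSubsets : (n : ℕ) → List (Subset n)
allSubsets = allVecs (false ∷ true ∷ [])

allFinVecs : (k n : ℕ) → List (Vec (Fin k) n)
allFinVecs k = allVecs (allFin k)

count : ∀ {A : Set} {P : A → Set} → Decidable P → List A → ℕ
count P? xs = length (filter P? xs)

AllDec : Set → Set₁
AllDec A = ∀ {Q : A → Set} → Decidable Q → Dec (∀ a → Q a)

allVec? : ∀ {A : Set} → AllDec A → (n : ℕ) → AllDec (Vec A n)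
allVec? all zero    P? = map′ (λ p → λ { [] → p }) (λ f → f []) (P? [])
allVec? all (suc n) P? =
  map′ (λ f → λ { (a ∷ v) → f a v }) (λ f a v → f (a ∷ v))
       (all (λ a → allVec? all n (λ v → P? (a ∷ v))))

allBool? : AllDec Bool
allBool? P? with P? false | P? true
... | yes pf | yes pt = yes λ { false → pf ; true → pt }
... | no ¬pf | _      = no λ f → ¬pf (f false)
... | _      | no ¬pt = no λ f → ¬pt (f true)

allFin? : ∀ {k} → AllDec (Fin k)
allFin? P? = FinP.all? P?

selSum : ∀ {n d} → Subset d → Vec (Fin n) d → ℕ
selSum []       []       = 0
selSum (b ∷ S)  (x ∷ v)  = (if b then toℕ x else 0) + selSum S v

ZeroSumFree : (n d : ℕ) → Vec (Fin n) d → Set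
ZeroSumFree n d v = ∀ (S : Subset d) → Nonempty S → ¬ (n ∣ selSum S v)

zeroSumFree? : (n d : ℕ) → Decidable (ZeroSumFree n d)
zeroSumFree? n d v =
  allVec? allBool? d (λ S → nonempty? S →-dec ¬? (n ∣? selSum S v))

α : (n d : ℕ) → ℕ
α n d = count (zeroSumFree? n d) (allFinVecs n d)

bits : ℕ → (d : ℕ) → Vec ℕ d
bits m zero    = []
bits m (suc d) = (m % 2) ∷ bits (m / 2) d

ncols : ℕ → ℕ
ncols d = 2 ^ d ∸ 1

-- column c of H_d (c = 0, …, 2^d - 2) is the binary expansion of c + 1;
-- these are exactly the non-zero 0/1 vectors of length d, each once.
col : (d : ℕ) → Fin (ncols d) → Vec ℕ d
col d c = bits (suc (toℕ c)) d

sumFin : (n : ℕ) → (Fin n → ℕ) → ℕ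
sumFin zero    f = 0
sumFin (suc n) f = f Fin.zero + sumFin n (λ i → f (Fin.suc i))
  where import Data.Fin as Fin

lincomb : (p d : ℕ) → Vec (Fin p) (ncols d) → Fin d → ℕ
lincomb p d λs k = sumFin (ncols d) (λ c → toℕ (lookup λs c) * lookup (col d c) k)

LinIndep : (p d : ℕ) → Subset (ncols d) → Set
LinIndep p d T =
  ∀ (λs : Vec (Fin p) (ncols d)) →
    (∀ c → c ∉ T → toℕ (lookup λs c) ≡ 0) →
    (∀ k → p ∣ lincomb p d λs k) →
    ∀ c → toℕ (lookup λs c) ≡ 0

linIndep? : (p d : ℕ) → Decidable (LinIndep p d)
linIndep? p d T =
  allVec? allFin? (ncols d) λ λs →
    allFin? (λ c → ¬? (c ∈? T) →-dec (toℕ (lookup λs c) ℕP.≟ 0))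
      →-dec (allFin? (λ k → p ∣? lincomb p d λs k)
      →-dec allFin? (λ c → toℕ (lookup λs c) ℕP.≟ 0))

-- dimension over 𝔽_p of the span of the columns of H_d indexed by S
-- = maximal size of a linearly independent subfamily
spanDim : (p d : ℕ) → Subset (ncols d) → ℕ
spanDim p d S =
  foldr _⊔_ 0
    (map ∣_∣ (filter (λ T → (T ⊆? S) ×-dec linIndep? p d T) (allSubsets (ncols d))))

m : (p d j i : ℕ) → ℕ
m p d j i = count (λ S → (∣ S ∣ ℕP.≟ j) ×-dec (spanDim p d S ℕP.≟ (d ∸ i)))
                  (allSubsets (ncols d))

altSum : (p d i : ℕ) → ℤ
altSum p d i = foldr ℤ._+_ (+ 0)
  (map (λ j → (-1ℤ ℤ.^ j) ℤ.* (+ m p d j i)) (map suc (upTo (ncols d))))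

monicEval : (d : ℕ) → (Fin d → ℤ) → ℤ → ℤ
monicEval d a x = (x ℤ.^ d) ℤ.+ foldr ℤ._+_ (+ 0) (map (λ i → a i ℤ.* (x ℤ.^ toℕ i)) (allFin d))

{-# OPTIONS --safe #-}
-- A vector v ∈ 𝔽_p^d is zero-sum-free iff no column of H_d is orthogonal to v, the
-- columns being the indicator vectors of the non-empty sets of coordinates.  By
-- inclusion–exclusion over sets T of columns, α_p^d = Σ_T (−1)^|T| N(T), where N(T)
-- counts the v orthogonal to all columns in T, and N(T) = p^(d − rk T): for
-- independent T remove one column at a time while keeping a dual basis; an arbitrary
-- T has the same solutions as a maximal independent subset.  Grouping the T by size j
-- and rank d − i gives α_p^d = p^d + Σ_i (Σ_j (−1)^j m(j,i)) p^i.  These coefficients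
-- are bounded independently of p, so once p exceeds all coefficient differences,
-- agreement of the two monic polynomials at p forces equal coefficients (base-p digits).
module Submission where

open import Algebra.Bundles using (CommutativeSemiring)
open import Data.Nat using (ℕ; _<_)
open import Data.Nat.Primality using (Prime)
open import Defs

module ListSum {c ℓ} (R : CommutativeSemiring c ℓ) where

  open import Data.List using (List; []; _∷_; _++_; map; foldr; concatMap)
  open import Function using (_∘_)
  open import Relation.Nullary using (Dec; yes; no; ¬_)
  open import Data.Empty using (⊥-elim)
  open import Relation.Nullary.Decidable using (_×-dec_)
  open import Relation.Binary using (DecidableEquality)
  open import Relation.Binary.PropositionalEquality as ≡ using (_≡_)

  open CommutativeSemiring R
  open import Relation.Binary.Reasoning.Setoid setoid
  open import Algebra.Definitions.RawMonoid +-rawMonoid using (_×_)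

  private
    variable
      A B : Set

  ∑ : List A → (A → Carrier) → Carrier
  ∑ xs f = foldr _+_ 0# (map f xs)

  syntax ∑ xs (λ x → e) = ∑[ x ∈ xs ] e

  ∑-cong : ∀ xs {f g : A → Carrier} → (∀ x → f x ≈ g x) → ∑ xs f ≈ ∑ xs g
  ∑-cong []       f≈g = refl
  ∑-cong (x ∷ xs) f≈g = +-cong (f≈g x) (∑-cong xs f≈g)

  ∑-map : ∀ xs (g : A → B) (f : B → Carrier) → ∑ (map g xs) f ≡ ∑ xs (f ∘ g)
  ∑-map []       g f = ≡.refl
  ∑-map (x ∷ xs) g f = ≡.cong (f (g x) +_) (∑-map xs g f)

  ∑-++ : ∀ xs ys (f : A → Carrier) → ∑ (xs ++ ys) f ≈ ∑ xs f + ∑ ys f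
  ∑-++ []       ys f = sym (+-identityˡ _)
  ∑-++ (x ∷ xs) ys f = trans (+-congˡ (∑-++ xs ys f)) (sym (+-assoc _ _ _))

  ∑-concatMap : ∀ xs (g : A → List B) (f : B → Carrier) →
                ∑ (concatMap g xs) f ≈ ∑[ x ∈ xs ] ∑ (g x) f
  ∑-concatMap []       g f = refl
  ∑-concatMap (x ∷ xs) g f =
    trans (∑-++ (g x) (concatMap g xs) f) (+-congˡ (∑-concatMap xs g f))

  ∑-zero : ∀ (xs : List A) → ∑[ x ∈ xs ] 0# ≈ 0#
  ∑-zero []       = refl
  ∑-zero (x ∷ xs) = trans (+-identityˡ _) (∑-zero xs)

  ∑-distrib-+ : ∀ xs (f g : A → Carrier) → ∑[ x ∈ xs ] (f x + g x) ≈ ∑ xs f + ∑ xs g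
  ∑-distrib-+ []       f g = sym (+-identityˡ 0#)
  ∑-distrib-+ (x ∷ xs) f g = begin
    f x + g x + ∑[ y ∈ xs ] (f y + g y)  ≈⟨ +-congˡ (∑-distrib-+ xs f g) ⟩
    f x + g x + (∑ xs f + ∑ xs g)        ≈⟨ +-assoc _ _ _ ⟩
    f x + (g x + (∑ xs f + ∑ xs g))      ≈⟨ +-congˡ (+-assoc _ _ _) ⟨
    f x + (g x + ∑ xs f + ∑ xs g)        ≈⟨ +-congˡ (+-congʳ (+-comm _ _)) ⟩
    f x + (∑ xs f + g x + ∑ xs g)        ≈⟨ +-congˡ (+-assoc _ _ _) ⟩
    f x + (∑ xs f + (g x + ∑ xs g))      ≈⟨ +-assoc _ _ _ ⟨
    f x + ∑ xs f + (g x + ∑ xs g)        ∎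

  *-distribˡ-∑ : ∀ k xs (f : A → Carrier) → k * ∑ xs f ≈ ∑[ x ∈ xs ] (k * f x)
  *-distribˡ-∑ k []       f = zeroʳ k
  *-distribˡ-∑ k (x ∷ xs) f = trans (distribˡ k _ _) (+-congˡ (*-distribˡ-∑ k xs f))

  *-distribʳ-∑ : ∀ k xs (f : A → Carrier) → ∑ xs f * k ≈ ∑[ x ∈ xs ] (f x * k)
  *-distribʳ-∑ k xs f =
    trans (*-comm _ k) (trans (*-distribˡ-∑ k xs f) (∑-cong xs (λ x → *-comm k (f x))))

  ∑-comm : ∀ xs ys (f : A → B → Carrier) →
           ∑[ x ∈ xs ] ∑[ y ∈ ys ] f x y ≈ ∑[ y ∈ ys ] ∑[ x ∈ xs ] f x y
  ∑-comm []       ys f = sym (∑-zero ys)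
  ∑-comm (x ∷ xs) ys f =
    trans (+-congˡ (∑-comm xs ys f)) (sym (∑-distrib-+ ys (f x) (λ y → ∑[ x′ ∈ xs ] f x′ y)))

  𝟙 : {P : Set} → Dec P → Carrier
  𝟙 (yes _) = 1#
  𝟙 (no _)  = 0#

  𝟙-yes : {P : Set} (P? : Dec P) → P → 𝟙 P? ≡ 1#
  𝟙-yes (yes _) _ = ≡.refl
  𝟙-yes (no ¬p) p = ⊥-elim (¬p p)

  𝟙-no : {P : Set} (P? : Dec P) → ¬ P → 𝟙 P? ≡ 0#
  𝟙-no (yes p) ¬p = ⊥-elim (¬p p)
  𝟙-no (no _)  _  = ≡.refl

  𝟙-cong : {P Q : Set} (P? : Dec P) (Q? : Dec Q) → (P → Q) → (Q → P) → 𝟙 P? ≡ 𝟙 Q?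
  𝟙-cong (yes _) (yes _) _   _   = ≡.refl
  𝟙-cong (yes p) (no ¬q) p⇒q _   = ⊥-elim (¬q (p⇒q p))
  𝟙-cong (no ¬p) (yes q) _   q⇒p = ⊥-elim (¬p (q⇒p q))
  𝟙-cong (no _)  (no _)  _   _   = ≡.refl

  𝟙-× : ∀ {P Q : Set} (P? : Dec P) (Q? : Dec Q) → 𝟙 (P? ×-dec Q?) ≈ 𝟙 P? * 𝟙 Q?
  𝟙-× (yes _) (yes _) = sym (*-identityˡ 1#)
  𝟙-× (yes _) (no _)  = sym (zeroʳ 1#)
  𝟙-× (no _)  Q?      = sym (zeroˡ (𝟙 Q?))

  private
    ∑-pick-× : ∀ (_≟_ : DecidableEquality A) xs a (f : A → Carrier) →
               ∑[ x ∈ xs ] (𝟙 (x ≟ a) * f x) ≈ count (_≟ a) xs × f a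
    ∑-pick-× _≟_ []       a f = refl
    ∑-pick-× _≟_ (x ∷ xs) a f with x ≟ a
    ... | yes ≡.refl = +-cong (*-identityˡ (f x)) (∑-pick-× _≟_ xs a f)
    ... | no _       = trans (+-cong (zeroˡ (f x)) (∑-pick-× _≟_ xs a f)) (+-identityˡ _)

  ∑-pick : ∀ (_≟_ : DecidableEquality A) xs a → count (_≟ a) xs ≡ 1 →
           (f : A → Carrier) → ∑[ x ∈ xs ] (𝟙 (x ≟ a) * f x) ≈ f a
  ∑-pick _≟_ xs a once f = begin
    ∑[ x ∈ xs ] (𝟙 (x ≟ a) * f x)  ≈⟨ ∑-pick-× _≟_ xs a f ⟩
    count (_≟ a) xs × f a          ≡⟨ ≡.cong (_× f a) once ⟩
    f a + 0#                       ≈⟨ +-identityʳ (f a) ⟩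
    f a                            ∎

module Counting where

  open import Data.Bool using (Bool; true; false)
  open import Data.Nat using (ℕ; zero; suc; _+_; _*_; _^_; _⊔_; _≤_)
  import Data.Nat.Properties as ℕP
  import Data.Fin as Fin
  open Fin using (Fin)
  import Data.Fin.Properties as FinP
  open import Data.Vec using (Vec; []; _∷_)
  import Data.Vec.Properties as VecP
  open import Data.List using (List; []; _∷_; map; filter; length; concatMap; allFin; foldr)
  import Data.List.Properties as ListP
  open import Data.List.Membership.Propositional using (_∈_)
  open import Data.List.Relation.Unary.Any as Any using (here; there)
  open import Data.List.Relation.Unary.All as All using (All; []; _∷_)
  open import Data.Sum using (_⊎_; inj₁; inj₂)
  open import Data.Fin.Subset using (Subset)
  open import Data.Product using (_,_)
  open import Function using (_∘_)
  open import Relation.Nullary using (yes; no; does; ¬_)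
  open import Relation.Nullary.Decidable using (_×-dec_; ¬?)
  open import Relation.Unary using (Decidable)
  open import Relation.Binary using (DecidableEquality)
  open import Relation.Binary.PropositionalEquality
  import Data.Bool.Properties as BoolP
  open ListSum ℕP.+-*-commutativeSemiring

  private
    variable
      A K : Set
      P Q R : A → Set

  count≡∑𝟙 : (P? : Decidable P) → ∀ xs → count P? xs ≡ ∑[ x ∈ xs ] 𝟙 (P? x)
  count≡∑𝟙 P? []       = refl
  count≡∑𝟙 P? (x ∷ xs) with P? x
  ... | yes _ = cong suc (count≡∑𝟙 P? xs)
  ... | no _  = count≡∑𝟙 P? xs

  count-cong : (P? : Decidable P) (Q? : Decidable Q) →
               (∀ {x} → P x → Q x) → (∀ {x} → Q x → P x) → ∀ xs → count P? xs ≡ count Q? xs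
  count-cong P? Q? P⇒Q Q⇒P xs = cong length (ListP.filter-≐ P? Q? (P⇒Q , Q⇒P) xs)

  count≡length : (P? : Decidable P) → (∀ x → P x) → ∀ xs → count P? xs ≡ length xs
  count≡length P? all xs = cong length (ListP.filter-all P? (universal xs))
    where
      universal : ∀ xs → All _ xs
      universal []       = []
      universal (x ∷ xs) = all x ∷ universal xs

  count-filter : (P? : Decidable P) (R? : Decidable R) →
                 ∀ xs → count P? (filter R? xs) ≡ count (λ x → P? x ×-dec R? x) xs
  count-filter P? R? []       = refl
  count-filter P? R? (x ∷ xs) with R? x
  ... | yes _ with P? x
  ...   | yes _ = cong suc (count-filter P? R? xs)
  ...   | no _  = count-filter P? R? xs
  count-filter P? R? (x ∷ xs) | no _ with P? x
  ...   | yes _ = count-filter P? R? xs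
  ...   | no _  = count-filter P? R? xs

  count-split : (P? : Decidable P) (R? : Decidable R) → ∀ xs →
                count P? xs ≡ count (λ x → P? x ×-dec ¬? (R? x)) xs + count (λ x → P? x ×-dec R? x) xs
  count-split P? R? []       = refl
  count-split P? R? (x ∷ xs) with P? x | R? x
  ... | yes _ | yes _ = trans (cong suc (count-split P? R? xs)) (sym (ℕP.+-suc _ _))
  ... | yes _ | no _  = cong suc (count-split P? R? xs)
  ... | no _  | yes _ = count-split P? R? xs
  ... | no _  | no _  = count-split P? R? xs

  count≡0 : (P? : Decidable P) → (∀ x → ¬ P x) → ∀ xs → count P? xs ≡ 0
  count≡0 P? none xs = cong length (ListP.filter-none P? (refute xs))
    where
      refute : ∀ xs → All _ xs
      refute []       = []
      refute (x ∷ xs) = none x ∷ refute xs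

  count-map : (P? : Decidable P) (f : K → A) → ∀ xs → count P? (map f xs) ≡ count (P? ∘ f) xs
  count-map P? f []       = refl
  count-map P? f (x ∷ xs) with does (P? (f x))
  ... | true  = cong suc (count-map P? f xs)
  ... | false = count-map P? f xs

  count-concatMap : (P? : Decidable P) (g : K → List A) → ∀ xs →
                    count P? (concatMap g xs) ≡ ∑[ x ∈ xs ] count P? (g x)
  count-concatMap P? g xs = begin
    count P? (concatMap g xs)          ≡⟨ count≡∑𝟙 P? (concatMap g xs) ⟩
    ∑ (concatMap g xs) (𝟙 ∘ P?)        ≡⟨ ∑-concatMap xs g (𝟙 ∘ P?) ⟩
    ∑[ x ∈ xs ] ∑ (g x) (𝟙 ∘ P?)       ≡⟨ ∑-cong xs (λ x → sym (count≡∑𝟙 P? (g x))) ⟩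
    ∑[ x ∈ xs ] count P? (g x)         ∎
    where open ≡-Reasoning

  length-allVecs : ∀ (xs : List A) n → length (allVecs xs n) ≡ length xs ^ n
  length-allVecs xs zero    = refl
  length-allVecs xs (suc n) = trans (length-concat xs) (cong (length xs *_) (length-allVecs xs n))
    where
      length-concat : ∀ ys → length (concatMap (λ y → map (y ∷_) (allVecs xs n)) ys) ≡ length ys * length (allVecs xs n)
      length-concat []       = refl
      length-concat (y ∷ ys) = trans (ListP.length-++ (map (y ∷_) (allVecs xs n)))
        (cong₂ _+_ (ListP.length-map (y ∷_) (allVecs xs n)) (length-concat ys))

  Enumerates : DecidableEquality A → List A → Set
  Enumerates _≟_ xs = ∀ a → count (_≟ a) xs ≡ 1

  module _ (_≟_ : DecidableEquality A) where

    count≡1⇒∈ : ∀ {a} xs → count (_≟ a) xs ≡ 1 → a ∈ xs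
    count≡1⇒∈ {a} (x ∷ xs) once with x ≟ a
    ... | yes refl = here refl
    ... | no _     = there (count≡1⇒∈ xs once)

    ∑-pick-enum : ∀ xs → Enumerates _≟_ xs → ∀ a (f : A → ℕ) → ∑[ x ∈ xs ] (𝟙 (x ≟ a) * f x) ≡ f a
    ∑-pick-enum xs enum a = ∑-pick _≟_ xs a (enum a)

    count-enum : (P? : Decidable P) → ∀ xs ys → Enumerates _≟_ xs → Enumerates _≟_ ys →
                 count P? xs ≡ count P? ys
    count-enum P? xs ys enum-xs enum-ys = begin
      count P? xs                                       ≡⟨ count≡∑𝟙 P? xs ⟩
      ∑[ x ∈ xs ] 𝟙 (P? x)                              ≡⟨ ∑-cong xs (λ x → sym (∑-pick-enum ys enum-ys x (𝟙 ∘ P?))) ⟩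
      ∑[ x ∈ xs ] ∑[ y ∈ ys ] (𝟙 (y ≟ x) * 𝟙 (P? y))    ≡⟨ ∑-comm xs ys _ ⟩
      ∑[ y ∈ ys ] ∑[ x ∈ xs ] (𝟙 (y ≟ x) * 𝟙 (P? y))    ≡⟨ ∑-cong ys (λ y → sym (*-distribʳ-∑ (𝟙 (P? y)) xs (𝟙 ∘ (y ≟_)))) ⟩
      ∑[ y ∈ ys ] (∑[ x ∈ xs ] 𝟙 (y ≟ x) * 𝟙 (P? y))    ≡⟨ ∑-cong ys (λ y → cong (_* 𝟙 (P? y)) (occurs-once y)) ⟩
      ∑[ y ∈ ys ] (1 * 𝟙 (P? y))                        ≡⟨ ∑-cong ys (λ y → ℕP.*-identityˡ (𝟙 (P? y))) ⟩
      ∑[ y ∈ ys ] 𝟙 (P? y)                              ≡⟨ count≡∑𝟙 P? ys ⟨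
      count P? ys                                       ∎
      where
        open ≡-Reasoning
        occurs-once : ∀ y → ∑[ x ∈ xs ] 𝟙 (y ≟ x) ≡ 1
        occurs-once y = begin
          ∑[ x ∈ xs ] 𝟙 (y ≟ x)  ≡⟨ count≡∑𝟙 (y ≟_) xs ⟨
          count (y ≟_) xs        ≡⟨ count-cong (y ≟_) (_≟ y) sym sym xs ⟩
          count (_≟ y) xs        ≡⟨ enum-xs y ⟩
          1                      ∎

    map-enumerates : ∀ xs (f g : A → A) → (∀ x → g (f x) ≡ x) → (∀ x → f (g x) ≡ x) →
                     Enumerates _≟_ xs → Enumerates _≟_ (map f xs)
    map-enumerates xs f g g∘f f∘g enum a = begin
      count (_≟ a) (map f xs)    ≡⟨ count-map (_≟ a) f xs ⟩
      count ((_≟ a) ∘ f) xs      ≡⟨ count-cong ((_≟ a) ∘ f) (_≟ g a) (λ {x} fx≡a → trans (sym (g∘f x)) (cong g fx≡a))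
                                                                (λ {x} x≡ga → trans (cong f x≡ga) (f∘g a)) xs ⟩
      count (_≟ g a) xs          ≡⟨ enum (g a) ⟩
      1                          ∎
      where open ≡-Reasoning

    count-∘-bijection : (P? : Decidable P) → ∀ xs (f g : A → A) → (∀ x → g (f x) ≡ x) → (∀ x → f (g x) ≡ x) →
                        Enumerates _≟_ xs → count (P? ∘ f) xs ≡ count P? xs
    count-∘-bijection P? xs f g g∘f f∘g enum =
      trans (sym (count-map P? f xs)) (count-enum P? (map f xs) xs (map-enumerates xs f g g∘f f∘g enum) enum)

  count-partition : (_≟_ : DecidableEquality K) → ∀ ks → Enumerates _≟_ ks →
                    (P? : Decidable P) (key : A → K) → ∀ xs →
                    count P? xs ≡ ∑[ k ∈ ks ] count (λ x → P? x ×-dec (k ≟ key x)) xs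
  count-partition _≟_ ks enum P? key xs = begin
    count P? xs                                           ≡⟨ count≡∑𝟙 P? xs ⟩
    ∑[ x ∈ xs ] 𝟙 (P? x)                                  ≡⟨ ∑-cong xs (λ x → sym (∑-pick-enum _≟_ ks enum (key x) (λ _ → 𝟙 (P? x)))) ⟩
    ∑[ x ∈ xs ] ∑[ k ∈ ks ] (𝟙 (k ≟ key x) * 𝟙 (P? x))    ≡⟨ ∑-comm xs ks _ ⟩
    ∑[ k ∈ ks ] ∑[ x ∈ xs ] (𝟙 (k ≟ key x) * 𝟙 (P? x))    ≡⟨ ∑-cong ks (λ k → ∑-cong xs (λ x →
                                                               trans (ℕP.*-comm (𝟙 (k ≟ key x)) _) (sym (𝟙-× (P? x) (k ≟ key x))))) ⟩
    ∑[ k ∈ ks ] ∑[ x ∈ xs ] 𝟙 (P? x ×-dec (k ≟ key x))   ≡⟨ ∑-cong ks (λ k → sym (count≡∑𝟙 _ xs)) ⟩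
    ∑[ k ∈ ks ] count (λ x → P? x ×-dec (k ≟ key x)) xs  ∎
    where open ≡-Reasoning

  module _ {B : Set} (_≟ᴬ_ : DecidableEquality A) (_≟ᴮ_ : DecidableEquality B) (f : A → B) where

    count-map-injective : (∀ {x y} → f x ≡ f y → x ≡ y) → ∀ a xs → count (_≟ᴮ f a) (map f xs) ≡ count (_≟ᴬ a) xs
    count-map-injective f-inj a xs =
      trans (count-map (_≟ᴮ f a) f xs) (count-cong _ (_≟ᴬ a) f-inj (cong f) xs)

    count-map-∉-image : ∀ {b} → (∀ x → f x ≢ b) → ∀ xs → count (_≟ᴮ b) (map f xs) ≡ 0
    count-map-∉-image ∉image xs = trans (count-map (_≟ᴮ _) f xs) (count≡0 _ ∉image xs)

  allFin-enumerates : ∀ n → Enumerates FinP._≟_ (allFin n)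
  allFin-enumerates (suc n) a
    rewrite sym (ListP.map-tabulate {n = n} (λ i → i) Fin.suc) with a
  ... | Fin.zero  = cong suc (count-map-∉-image FinP._≟_ FinP._≟_ Fin.suc (λ x ()) (allFin n))
  ... | Fin.suc b = trans (count-map-injective FinP._≟_ FinP._≟_ Fin.suc FinP.suc-injective b (allFin n))
                          (allFin-enumerates n b)

  allVecs-enumerates : (_≟_ : DecidableEquality A) → ∀ xs → Enumerates _≟_ xs →
                       ∀ n → Enumerates (VecP.≡-dec _≟_) (allVecs xs n)
  allVecs-enumerates _≟_ xs enum zero    []      = refl
  allVecs-enumerates _≟_ xs enum (suc n) (a ∷ v) = begin
    count (_≟ⱽ (a ∷ v)) (concatMap (λ x → map (x ∷_) (allVecs xs n)) xs)  ≡⟨ count-concatMap _ _ xs ⟩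
    ∑[ x ∈ xs ] count (_≟ⱽ (a ∷ v)) (map (x ∷_) (allVecs xs n))           ≡⟨ ∑-cong xs row ⟩
    ∑[ x ∈ xs ] (𝟙 (x ≟ a) * 1)                                        ≡⟨ ∑-pick-enum _≟_ xs enum a (λ _ → 1) ⟩
    1                                                                  ∎
    where
      open ≡-Reasoning
      _≟ⱽ_ = VecP.≡-dec _≟_
      row : ∀ x → count (_≟ⱽ (a ∷ v)) (map (x ∷_) (allVecs xs n)) ≡ 𝟙 (x ≟ a) * 1
      row x with x ≟ a
      ... | yes refl = trans (count-map-injective (VecP.≡-dec _≟_) _≟ⱽ_ (x ∷_) VecP.∷-injectiveʳ v (allVecs xs n))
                             (allVecs-enumerates _≟_ xs enum n v)
      ... | no x≢a   = count-map-∉-image (VecP.≡-dec _≟_) _≟ⱽ_ (x ∷_) (λ w eq → x≢a (VecP.∷-injectiveˡ eq)) (allVecs xs n)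

  ∑-const : ∀ (xs : List A) c → ∑[ x ∈ xs ] c ≡ length xs * c
  ∑-const []       c = refl
  ∑-const (x ∷ xs) c = cong (c +_) (∑-const xs c)

  allSubsets-enumerates : ∀ m → Enumerates (VecP.≡-dec BoolP._≟_) (allSubsets m)
  allSubsets-enumerates = allVecs-enumerates BoolP._≟_ (false ∷ true ∷ []) λ { false → refl ; true → refl }

  max-upper : ∀ {v xs} → v ∈ xs → v ≤ foldr _⊔_ 0 xs
  max-upper {v} {xs} v∈xs = ListP.foldr-preservesᵒ {P = v ≤_} keeps 0 xs (inj₂ (Any.map (λ { refl → ℕP.≤-refl }) v∈xs))
    where
      keeps : ∀ x y → v ≤ x ⊎ v ≤ y → v ≤ x ⊔ y
      keeps x y (inj₁ v≤x) = ℕP.≤-trans v≤x (ℕP.m≤m⊔n x y)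
      keeps x y (inj₂ v≤y) = ℕP.≤-trans v≤y (ℕP.m≤n⊔m x y)

  max-attained : ∀ xs → foldr _⊔_ 0 xs ≡ 0 ⊎ foldr _⊔_ 0 xs ∈ xs
  max-attained xs = ListP.foldr-preservesᵇ {P = λ m → m ≡ 0 ⊎ m ∈ xs} keeps (inj₁ refl) (All.tabulate inj₂)
    where
      keeps : ∀ {x y} → x ≡ 0 ⊎ x ∈ xs → y ≡ 0 ⊎ y ∈ xs →
              x ⊔ y ≡ 0 ⊎ x ⊔ y ∈ xs
      keeps {x} {y} px py with ℕP.⊔-sel x y
      ... | inj₁ x⊔y≡x = subst (λ m → m ≡ 0 ⊎ m ∈ xs) (sym x⊔y≡x) px
      ... | inj₂ x⊔y≡y = subst (λ m → m ≡ 0 ⊎ m ∈ xs) (sym x⊔y≡y) py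

  allSubsets-complete : ∀ {m} (B : Subset m) → B ∈ allSubsets m
  allSubsets-complete {m} B = count≡1⇒∈ (VecP.≡-dec BoolP._≟_) (allSubsets m) (allSubsets-enumerates m B)

module InclusionExclusion where

  open Counting using (count-cong; count-filter; count-split; count≡length)
  open import Data.Bool using (true; false)
  open import Data.Nat as ℕ using (ℕ; zero; suc)
  open import Data.Integer as ℤ using (ℤ; +_; _+_; _*_; _-_; -_; -1ℤ)
  import Data.Integer.Properties as ℤP
  open import Data.Integer.Tactic.RingSolver using (solve-∀)
  open import Data.Fin using (Fin; zero; suc)
  open import Data.Fin.Subset using (Subset; _∈_; ∣_∣; inside; outside)
  open import Data.Fin.Subset.Properties using (_∈?_)
  open import Data.Vec as Vec using (_∷_; here; there)
  open import Data.List using ([]; _∷_; map; filter)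
  open import Data.Product using (_,_)
  open import Relation.Nullary using (¬_)
  open import Relation.Nullary.Decidable using (_×-dec_; _→-dec_; ¬?)
  open import Relation.Unary using (Decidable)
  open import Relation.Binary.PropositionalEquality
  open ListSum ℤP.+-*-commutativeSemiring

  neg-∑ : ∀ {B : Set} ys (f : B → ℤ) → - ∑ ys f ≡ ∑[ y ∈ ys ] (- f y)
  neg-∑ ys f = trans (sym (ℤP.-1*i≡-i _)) (trans (*-distribˡ-∑ -1ℤ ys f) (∑-cong ys (λ y → ℤP.-1*i≡-i (f y))))

  ∑-allSubsets-suc : ∀ m (F : Subset (suc m) → ℤ) →
    ∑[ T ∈ allSubsets (suc m) ] F T ≡ ∑[ T ∈ allSubsets m ] F (outside ∷ T) + ∑[ T ∈ allSubsets m ] F (inside ∷ T)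
  ∑-allSubsets-suc m F = begin
    ∑[ T ∈ allSubsets (suc m) ] F T                             ≡⟨ ∑-concatMap (false ∷ true ∷ []) (λ b → map (b ∷_) S) F ⟩
    ∑ (map (outside ∷_) S) F + (∑ (map (inside ∷_) S) F + + 0)  ≡⟨ cong (λ x → ∑ (map (outside ∷_) S) F + x) (ℤP.+-identityʳ _) ⟩
    ∑ (map (outside ∷_) S) F + ∑ (map (inside ∷_) S) F          ≡⟨ cong₂ _+_ (∑-map S (outside ∷_) F) (∑-map S (inside ∷_) F) ⟩
    ∑[ T ∈ S ] F (outside ∷ T) + ∑[ T ∈ S ] F (inside ∷ T)      ∎
    where
      open ≡-Reasoning
      S = allSubsets m

  module _ {A : Set} {m : ℕ} {Q : Fin m → A → Set} (Q? : ∀ c → Decidable (Q c)) where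

    NoneHolds : A → Set
    NoneHolds x = ∀ c → ¬ Q c x

    AllHoldOn : Subset m → A → Set
    AllHoldOn T x = ∀ c → c ∈ T → Q c x

    noneHolds? : Decidable NoneHolds
    noneHolds? x = allFin? (λ c → ¬? (Q? c x))

    allHoldOn? : ∀ T → Decidable (AllHoldOn T)
    allHoldOn? T x = allFin? (λ c → (c ∈? T) →-dec Q? c x)

  module _ {A : Set} {m : ℕ} {Q : Fin (suc m) → A → Set} (Q? : ∀ c → Decidable (Q c)) where

    private
      Q₀? : Decidable (Q zero)
      Q₀? = Q? zero
      Q₊? : ∀ c → Decidable (Q (suc c))
      Q₊? c = Q? (suc c)

    count-noneHolds-suc : ∀ xs → + count (noneHolds? Q?) xs ≡ + count (noneHolds? Q₊?) xs - + count (noneHolds? Q₊?) (filter Q₀? xs)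
    count-noneHolds-suc xs = begin
      + count (noneHolds? Q?) xs    ≡⟨ cong +_ (count-cong (noneHolds? Q?) (λ x → noneHolds? Q₊? x ×-dec ¬? (Q₀? x))
                                                 (λ none → (λ c → none (suc c)) , none zero)
                                                 (λ { (none₊ , ¬q₀) zero → ¬q₀ ; (none₊ , ¬q₀) (suc c) → none₊ c }) xs) ⟩
      + a                           ≡⟨ lemma (+ a) (+ b) ⟩
      + a + + b - + b               ≡⟨ cong (_- + b) (ℤP.pos-+ a b) ⟨
      + (a ℕ.+ b) - + b             ≡⟨ cong₂ (λ u v → + u - + v) (count-split (noneHolds? Q₊?) Q₀? xs)
                                                               (count-filter (noneHolds? Q₊?) Q₀? xs) ⟨
      + count (noneHolds? Q₊?) xs - + count (noneHolds? Q₊?) (filter Q₀? xs) ∎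
      where
        open ≡-Reasoning
        a = count (λ x → noneHolds? Q₊? x ×-dec ¬? (Q₀? x)) xs
        b = count (λ x → noneHolds? Q₊? x ×-dec Q₀? x) xs
        lemma : ∀ a b → a ≡ a + b - b
        lemma = solve-∀

    count-allHoldOn-outside : ∀ T xs → count (allHoldOn? Q₊? T) xs ≡ count (allHoldOn? Q? (outside ∷ T)) xs
    count-allHoldOn-outside T = count-cong (allHoldOn? Q₊? T) (allHoldOn? Q? (outside ∷ T))
      (λ all → λ { (suc c) (there c∈T) → all c c∈T })
      (λ all c c∈T → all (suc c) (there c∈T))

    count-allHoldOn-inside : ∀ T xs → count (allHoldOn? Q₊? T) (filter Q₀? xs) ≡ count (allHoldOn? Q? (inside ∷ T)) xs
    count-allHoldOn-inside T xs = trans (count-filter (allHoldOn? Q₊? T) Q₀? xs) (count-cong _ (allHoldOn? Q? (inside ∷ T))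
      (λ { (all , q₀) zero here → q₀ ; (all , q₀) (suc c) (there c∈T) → all c c∈T })
      (λ all → (λ c c∈T → all (suc c) (there c∈T)) , all zero here) xs)

  inclusion-exclusion : ∀ {A : Set} m {Q : Fin m → A → Set} (Q? : ∀ c → Decidable (Q c)) xs →
    + count (noneHolds? Q?) xs ≡ ∑[ T ∈ allSubsets m ] (-1ℤ ℤ.^ ∣ T ∣ * + count (allHoldOn? Q? T) xs)
  inclusion-exclusion zero Q? xs =
    trans (cong +_ (trans (count≡length (noneHolds? Q?) (λ x ()) xs)
                          (sym (count≡length (allHoldOn? Q? Vec.[]) (λ x ()) xs))))
          (sym (trans (ℤP.+-identityʳ _) (ℤP.*-identityˡ _)))
  inclusion-exclusion (suc m) Q? xs = begin
    + count (noneHolds? Q?) xs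
      ≡⟨ count-noneHolds-suc Q? xs ⟩
    + count (noneHolds? Q₊?) xs - + count (noneHolds? Q₊?) (filter Q₀? xs)
      ≡⟨ cong₂ _-_ (inclusion-exclusion m Q₊? xs) (inclusion-exclusion m Q₊? (filter Q₀? xs)) ⟩
    ∑[ T ∈ S ] (sgn T * + count (allHoldOn? Q₊? T) xs) - ∑[ T ∈ S ] (sgn T * + count (allHoldOn? Q₊? T) (filter Q₀? xs))
      ≡⟨ cong₂ _+_ (∑-cong S without-c₀) (trans (neg-∑ S _) (∑-cong S with-c₀)) ⟩
    ∑[ T ∈ S ] F (outside ∷ T) + ∑[ T ∈ S ] F (inside ∷ T)
      ≡⟨ ∑-allSubsets-suc m F ⟨
    ∑[ T ∈ allSubsets (suc m) ] F T ∎
    where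
      open ≡-Reasoning
      S = allSubsets m
      Q₀? = Q? zero
      Q₊? = λ c → Q? (suc c)
      sgn : ∀ {k} → Subset k → ℤ
      sgn T = -1ℤ ℤ.^ ∣ T ∣
      F : Subset (suc m) → ℤ
      F T = sgn T * + count (allHoldOn? Q? T) xs
      without-c₀ : ∀ T → sgn T * + count (allHoldOn? Q₊? T) xs ≡ F (outside ∷ T)
      without-c₀ T = cong (λ k → sgn T * + k) (count-allHoldOn-outside Q? T xs)
      with-c₀ : ∀ T → - (sgn T * + count (allHoldOn? Q₊? T) (filter Q₀? xs)) ≡ F (inside ∷ T)
      with-c₀ T = trans (ℤP.neg-distribˡ-* (sgn T) _)
        (cong₂ (λ s k → s * + k) (sym (ℤP.-1*i≡-i (sgn T))) (count-allHoldOn-inside Q? T xs))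

module Modulo (p : ℕ) where

  open import Level using (0ℓ)
  open import Algebra.Bundles using (CommutativeRing)
  open import Data.Nat as ℕ using (ℕ; zero; suc; NonZero)
  import Data.Nat.Properties as ℕP
  import Data.Nat.Divisibility as ℕ∣
  open import Data.Nat.Primality using (Prime; prime⇒nonZero; prime⇒nonTrivial)
  open import Data.Nat.Coprimality using (prime⇒coprime; coprime-Bézout)
  open import Data.Nat.GCD using (module Bézout)
  open import Data.Integer using (ℤ; +_; _+_; _*_; _-_; -_; ∣_∣; 0ℤ; 1ℤ)
  import Data.Integer.Properties as ℤP
  open import Data.Integer.Divisibility.Signed
    using (_∣_; divides; ∣m∣n⇒∣m+n; ∣m⇒∣-m; ∣n⇒∣m*n; ∣⇒∣ᵤ; ∣ᵤ⇒∣)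
  open import Data.Integer.DivMod using (_%ℕ_; _/ℕ_; n%ℕd<d; a≡a%ℕn+[a/ℕn]*n)
  open import Data.Integer.Tactic.RingSolver using (solve-∀)
  open import Data.Fin using (Fin; toℕ; fromℕ<)
  import Data.Fin.Properties as FinP
  open import Data.Product using (∃; _,_)
  open import Data.Empty using (⊥-elim)
  open import Relation.Nullary using (¬_; Dec)
  open import Relation.Nullary.Decidable using (map′)
  open import Relation.Binary.PropositionalEquality
  open import Relation.Binary.Structures using (IsEquivalence)

  -- A record rather than a synonym for + p ∣ a - b, so that a and b can be inferred.
  infix 4 _≋_
  record _≋_ (a b : ℤ) : Set where
    constructor mod
    field divides-difference : + p ∣ a - b

  private
    ∣-resp : ∀ {x y} → x ≡ y → + p ∣ x → + p ∣ y
    ∣-resp = subst (+ p ∣_)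

  ≋-reflexive : ∀ {a b} → a ≡ b → a ≋ b
  ≋-reflexive {a} refl = mod (divides 0ℤ (ℤP.+-inverseʳ a))

  ≋-sym : ∀ {a b} → a ≋ b → b ≋ a
  ≋-sym {a} {b} (mod a-b) = mod (∣-resp (lemma a b) (∣m⇒∣-m a-b))
    where lemma : ∀ a b → - (a - b) ≡ b - a
          lemma = solve-∀

  ≋-trans : ∀ {a b c} → a ≋ b → b ≋ c → a ≋ c
  ≋-trans {a} {b} {c} (mod a-b) (mod b-c) = mod (∣-resp (lemma a b c) (∣m∣n⇒∣m+n a-b b-c))
    where lemma : ∀ a b c → (a - b) + (b - c) ≡ a - c
          lemma = solve-∀

  ≋-+-cong : ∀ {a b c d} → a ≋ b → c ≋ d → a + c ≋ b + d
  ≋-+-cong {a} {b} {c} {d} (mod a-b) (mod c-d) = mod (∣-resp (lemma a b c d) (∣m∣n⇒∣m+n a-b c-d))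
    where lemma : ∀ a b c d → (a - b) + (c - d) ≡ (a + c) - (b + d)
          lemma = solve-∀

  ≋-*-cong : ∀ {a b c d} → a ≋ b → c ≋ d → a * c ≋ b * d
  ≋-*-cong {a} {b} {c} {d} (mod a-b) (mod c-d) =
    mod (∣-resp (lemma a b c d) (∣m∣n⇒∣m+n (∣n⇒∣m*n c a-b) (∣n⇒∣m*n b c-d)))
    where lemma : ∀ a b c d → c * (a - b) + b * (c - d) ≡ a * c - b * d
          lemma = solve-∀

  ≋-neg-cong : ∀ {a b} → a ≋ b → - a ≋ - b
  ≋-neg-cong {a} {b} (mod a-b) = mod (∣-resp (lemma a b) (∣m⇒∣-m a-b))
    where lemma : ∀ a b → - (a - b) ≡ - a - - b
          lemma = solve-∀

  ≋-isEquivalence : IsEquivalence _≋_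
  ≋-isEquivalence = record { refl = ≋-reflexive refl ; sym = ≋-sym ; trans = ≋-trans }

  -- ℤ with congruence modulo p as its equality; every ring law already holds up to ≡.
  ℤ/p : CommutativeRing 0ℓ 0ℓ
  ℤ/p = record
    { Carrier = ℤ ; _≈_ = _≋_ ; _+_ = _+_ ; _*_ = _*_ ; -_ = -_ ; 0# = 0ℤ ; 1# = 1ℤ
    ; isCommutativeRing = record
      { isRing = record
        { +-isAbelianGroup = record
          { isGroup = record
            { isMonoid = record
              { isSemigroup = record
                { isMagma = record { isEquivalence = ≋-isEquivalence ; ∙-cong = ≋-+-cong }
                ; assoc = λ a b c → ≋-reflexive (ℤP.+-assoc a b c) }
              ; identity = (λ a → ≋-reflexive (ℤP.+-identityˡ a)) , (λ a → ≋-reflexive (ℤP.+-identityʳ a)) }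
            ; inverse = (λ a → ≋-reflexive (ℤP.+-inverseˡ a)) , (λ a → ≋-reflexive (ℤP.+-inverseʳ a))
            ; ⁻¹-cong = ≋-neg-cong }
          ; comm = λ a b → ≋-reflexive (ℤP.+-comm a b) }
        ; *-cong = ≋-*-cong
        ; *-assoc = λ a b c → ≋-reflexive (ℤP.*-assoc a b c)
        ; *-identity = (λ a → ≋-reflexive (ℤP.*-identityˡ a)) , (λ a → ≋-reflexive (ℤP.*-identityʳ a))
        ; distrib = (λ a b c → ≋-reflexive (ℤP.*-distribˡ-+ a b c)) , (λ a b c → ≋-reflexive (ℤP.*-distribʳ-+ a b c)) }
      ; *-comm = λ a b → ≋-reflexive (ℤP.*-comm a b) } }

  open CommutativeRing ℤ/p public using (+-congˡ; +-congʳ; *-congˡ; *-congʳ) renaming (setoid to ≋-setoid)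
  open import Relation.Binary.Reasoning.Setoid ≋-setoid

  multiple≋0 : ∀ q → q * + p ≋ 0ℤ
  multiple≋0 q = mod (divides q (ℤP.+-identityʳ (q * + p)))

  ∣⇒≋0 : ∀ {n} → p ℕ∣.∣ n → + n ≋ 0ℤ
  ∣⇒≋0 {n} p∣n = mod (∣-resp (sym (ℤP.+-identityʳ (+ n))) (∣ᵤ⇒∣ p∣n))

  ≋0⇒∣ : ∀ {n} → + n ≋ 0ℤ → p ℕ∣.∣ n
  ≋0⇒∣ {n} (mod p∣n-0) = ∣⇒∣ᵤ (∣-resp (ℤP.+-identityʳ (+ n)) p∣n-0)

  small-≋⇒≡ : ∀ {a b} → ∣ a - b ∣ ℕ.< p → a ≋ b → a ≡ b
  small-≋⇒≡ {a} {b} small (mod p∣a-b) with ∣ a - b ∣ in ∣a-b∣≡ | ∣⇒∣ᵤ p∣a-b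
  ... | zero  | _     = ℤP.i-j≡0⇒i≡j a b (ℤP.∣i∣≡0⇒i≡0 ∣a-b∣≡)
  ... | suc _ | p∣a-b = ⊥-elim (ℕP.<⇒≱ small (ℕ∣.∣⇒≤ p∣a-b))

  small-≋0⇒≡0 : ∀ {x} → ∣ x ∣ ℕ.< p → x ≋ 0ℤ → x ≡ 0ℤ
  small-≋0⇒≡0 {x} small = small-≋⇒≡ (subst (ℕ._< p) (cong ∣_∣ (sym (ℤP.+-identityʳ x))) small)

  module _ {{_ : NonZero p}} where

    toℤ : Fin p → ℤ
    toℤ x = + toℕ x

    residue : ℤ → Fin p
    residue z = fromℕ< (n%ℕd<d z p)

    toℤ-residue : ∀ z → toℤ (residue z) ≋ z
    toℤ-residue z = begin
      toℤ (residue z)                  ≡⟨ cong +_ (FinP.toℕ-fromℕ< (n%ℕd<d z p)) ⟩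
      + (z %ℕ p)                       ≡⟨ ℤP.+-identityʳ _ ⟨
      + (z %ℕ p) + 0ℤ                  ≈⟨ +-congˡ {+ (z %ℕ p)} (multiple≋0 (z /ℕ p)) ⟨
      + (z %ℕ p) + (z /ℕ p) * + p      ≡⟨ a≡a%ℕn+[a/ℕn]*n z p ⟨
      z                                ∎

    toℤ-injective : ∀ {x y} → toℤ x ≋ toℤ y → x ≡ y
    toℤ-injective {x} {y} x≋y = FinP.toℕ-injective (ℤP.+-injective (small-≋⇒≡ small x≋y))
      where
        small : ∣ toℤ x - toℤ y ∣ ℕ.< p
        small = ℕP.≤-<-trans (subst (ℕ._≤ toℕ x ℕ.⊔ toℕ y) (cong ∣_∣ (sym (ℤP.m-n≡m⊖n (toℕ x) (toℕ y))))
                                    (ℤP.∣m⊝n∣≤m⊔n (toℕ x) (toℕ y)))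
                             (ℕP.⊔-lub (FinP.toℕ<n x) (FinP.toℕ<n y))

    residue-toℤ : ∀ x → residue (toℤ x) ≡ x
    residue-toℤ x = toℤ-injective (toℤ-residue (toℤ x))

    residue-cong : ∀ {a b} → a ≋ b → residue a ≡ residue b
    residue-cong {a} {b} a≋b = toℤ-injective (begin
      toℤ (residue a)  ≈⟨ toℤ-residue a ⟩
      a                ≈⟨ a≋b ⟩
      b                ≈⟨ toℤ-residue b ⟨
      toℤ (residue b)  ∎)

    toℤ≋0⇒≡0 : ∀ {x} → toℤ x ≋ 0ℤ → toℕ x ≡ 0
    toℤ≋0⇒≡0 {x} x≋0 = ℤP.+-injective (small-≋0⇒≡0 (FinP.toℕ<n x) x≋0)

    ≋0? : ∀ z → Dec (z ≋ 0ℤ)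
    ≋0? z = map′ (λ r≡0 → ≋-trans (≋-sym (toℤ-residue z)) (≋-reflexive (cong +_ r≡0)))
                 (λ z≋0 → toℤ≋0⇒≡0 (≋-trans (toℤ-residue z) z≋0))
                 (toℕ (residue z) ℕP.≟ 0)

  module _ (prime : Prime p) where

    private
      instance
        p≢0 : NonZero p
        p≢0 = prime⇒nonZero prime

    1≉0 : ¬ 1ℤ ≋ 0ℤ
    1≉0 1≋0 with small-≋0⇒≡0 (ℕ.nonTrivial⇒n>1 p {{prime⇒nonTrivial prime}}) 1≋0
    ... | ()

    private
      cast : ∀ m n → + (1 ℕ.+ m ℕ.* n) ≡ 1ℤ + + m * + n
      cast m n = trans (ℤP.pos-+ 1 (m ℕ.* n)) (cong (λ z → 1ℤ + z) (ℤP.pos-* m n))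

      bézout-inverse : ∀ {a r} → a ≋ + r → Bézout.Identity 1 p r → ∃ λ b → a * b ≋ 1ℤ
      bézout-inverse {a} {r} a≋r (Bézout.+- u v 1+vr≡up) = - + v , (begin
        a * - + v                    ≈⟨ *-congʳ a≋r ⟩
        + r * - + v                  ≡⟨ lemma (+ r) (+ v) ⟩
        1ℤ - (1ℤ + + v * + r)        ≡⟨ cong (λ z → 1ℤ - z) (trans (sym (cast v r)) (trans (cong +_ 1+vr≡up) (ℤP.pos-* u p))) ⟩
        1ℤ - + u * + p               ≈⟨ +-congˡ {1ℤ} (≋-neg-cong (multiple≋0 (+ u))) ⟩
        1ℤ                           ∎)
        where lemma : ∀ r v → r * - v ≡ 1ℤ - (1ℤ + v * r)
              lemma = solve-∀
      bézout-inverse {a} {r} a≋r (Bézout.-+ u v 1+up≡vr) = + v , (begin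
        a * + v                      ≈⟨ *-congʳ a≋r ⟩
        + r * + v                    ≡⟨ trans (ℤP.*-comm (+ r) (+ v)) (sym (ℤP.pos-* v r)) ⟩
        + (v ℕ.* r)                  ≡⟨ cong +_ 1+up≡vr ⟨
        + (1 ℕ.+ u ℕ.* p)            ≡⟨ cast u p ⟩
        1ℤ + + u * + p               ≈⟨ +-congˡ {1ℤ} (multiple≋0 (+ u)) ⟩
        1ℤ                           ∎)

      residue-inverse : ∀ {a} r → a ≋ + r → r ≢ 0 → r ℕ.< p → ∃ λ b → a * b ≋ 1ℤ
      residue-inverse r a≋r r≢0 r<p =
        bézout-inverse a≋r (coprime-Bézout (prime⇒coprime prime {{ℕ.≢-nonZero r≢0}} r<p))

    inverse : ∀ a → ¬ a ≋ 0ℤ → ∃ λ b → a * b ≋ 1ℤ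
    inverse a a≉0 = residue-inverse (toℕ (residue a)) a≋r
      (λ r≡0 → a≉0 (≋-trans a≋r (≋-reflexive (cong +_ r≡0)))) (FinP.toℕ<n (residue a))
      where
        a≋r : a ≋ toℤ (residue a)
        a≋r = ≋-sym (toℤ-residue a)

    cancel-unitˡ : ∀ {a b} → ¬ a ≋ 0ℤ → a * b ≋ 0ℤ → b ≋ 0ℤ
    cancel-unitˡ {a} {b} a≉0 ab≋0 = cancel (inverse a a≉0)
      where
        lemma : ∀ a b c → a * c * b ≡ c * (a * b)
        lemma = solve-∀
        cancel : ∃ (λ c → a * c ≋ 1ℤ) → b ≋ 0ℤ
        cancel (c , ac≋1) = begin
          b              ≡⟨ ℤP.*-identityˡ b ⟨
          1ℤ * b         ≈⟨ *-congʳ ac≋1 ⟨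
          a * c * b      ≡⟨ lemma a b c ⟩
          c * (a * b)    ≈⟨ *-congˡ {c} ab≋0 ⟩
          c * 0ℤ         ≡⟨ ℤP.*-zeroʳ c ⟩
          0ℤ             ∎

module SubsetProperties where

  open import Data.Nat using (suc)
  open import Data.Nat.Properties using (1+n≢0)
  open import Data.Empty using (⊥-elim)
  open import Relation.Nullary using (yes; no)
  open import Data.Fin using (Fin; suc)
  open import Data.Fin.Subset using (Subset; _∈_; _∉_; _⊆_; _⊂_; _-_; ∣_∣; ⁅_⁆; _∪_; inside; outside; Nonempty)
  open import Data.Fin.Subset.Properties using (p─⊥≡p; nonempty?; Empty-unique; ∣⊥∣≡0; x∈p∪q⁻; x∈p∪q⁺; q⊆p∪q; x∈⁅x⁆; x∈⁅y⁆⇒x≡y)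
  open import Data.Sum using (inj₁; inj₂)
  open import Data.Product using (_,_)
  open import Data.Vec using (_∷_; here; there)
  open import Relation.Binary.PropositionalEquality using (_≡_; cong; sym; subst; trans)

  x∉p-x : ∀ {n} (p : Subset n) x → x ∉ p - x
  x∉p-x (b ∷ p) (suc x) (there x∈p-x) = x∉p-x p x x∈p-x

  x∈p⇒∣p-x∣+1≡∣p∣ : ∀ {n} {p : Subset n} {x} → x ∈ p → suc ∣ p - x ∣ ≡ ∣ p ∣
  x∈p⇒∣p-x∣+1≡∣p∣ {p = inside ∷ p}  here        = cong (λ q → suc ∣ q ∣) (p─⊥≡p p)
  x∈p⇒∣p-x∣+1≡∣p∣ {p = inside ∷ p}  (there x∈p) = cong suc (x∈p⇒∣p-x∣+1≡∣p∣ x∈p)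
  x∈p⇒∣p-x∣+1≡∣p∣ {p = outside ∷ p} (there x∈p) = x∈p⇒∣p-x∣+1≡∣p∣ x∈p

  ⁅x⁆∪p⊆q : ∀ {n} {p q : Subset n} {x} → x ∈ q → p ⊆ q → ⁅ x ⁆ ∪ p ⊆ q
  ⁅x⁆∪p⊆q {p = p} {x = x} x∈q p⊆q y∈ with x∈p∪q⁻ ⁅ x ⁆ p y∈
  ... | inj₁ y∈⁅x⁆ = subst (_∈ _) (sym (x∈⁅y⁆⇒x≡y x y∈⁅x⁆)) x∈q
  ... | inj₂ y∈p   = p⊆q y∈p

  p⊂⁅x⁆∪p : ∀ {n} {p : Subset n} {x} → x ∉ p → p ⊂ ⁅ x ⁆ ∪ p
  p⊂⁅x⁆∪p {p = p} {x} x∉p = q⊆p∪q ⁅ x ⁆ p , x , x∈p∪q⁺ (inj₁ (x∈⁅x⁆ x)) , x∉p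

  ∣p∣≡1+m⇒nonempty : ∀ {n m} {p : Subset n} → ∣ p ∣ ≡ suc m → Nonempty p
  ∣p∣≡1+m⇒nonempty {n} {p = p} ∣p∣≡1+m with nonempty? p
  ... | yes nonempty = nonempty
  ... | no empty     = ⊥-elim (1+n≢0 (trans (sym ∣p∣≡1+m) (trans (cong ∣_∣ (Empty-unique empty)) (∣⊥∣≡0 n))))

  ∣p∣≡0⇒x∉p : ∀ {n} {p : Subset n} {x} → ∣ p ∣ ≡ 0 → x ∉ p
  ∣p∣≡0⇒x∉p ∣p∣≡0 x∈p = 1+n≢0 (trans (x∈p⇒∣p-x∣+1≡∣p∣ x∈p) ∣p∣≡0)

module Columns where

  open import Data.Bool using (Bool; true; false)
  open import Data.Nat using (ℕ; zero; suc; _+_; _*_; _^_; _∸_; _%_; _/_; _<_; _≤_; z≤n; s≤s)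
  import Data.Nat.Properties as ℕP
  open import Data.Nat.DivMod using ([m+kn]%n≡m%n; m<n⇒m%n≡m; m≡m%n+[m/n]*n; m%n<n; m<n*o⇒m/o<n)
  open import Data.Fin as Fin using (Fin; toℕ; fromℕ<)
  import Data.Fin.Properties as FinP
  open import Data.Fin.Subset using (Subset; Nonempty)
  open import Data.Vec using (Vec; []; _∷_; lookup; map; there)
  import Data.Vec.Properties as VecP
  open import Data.Product using (∃; _,_)
  open import Data.Empty using (⊥-elim)
  open import Relation.Nullary using (yes; no)
  open import Relation.Binary.PropositionalEquality

  bit : Bool → ℕ
  bit true  = 1
  bit false = 0

  bit<2 : ∀ b → bit b < 2
  bit<2 true  = s≤s (s≤s z≤n)
  bit<2 false = s≤s z≤n

  value : ∀ {d} → Subset d → ℕ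
  value []      = 0
  value (b ∷ S) = bit b + value S * 2

  bits-value : ∀ {d} (S : Subset d) → bits (value S) d ≡ map bit S
  bits-value []              = refl
  bits-value {suc d} (b ∷ S) = cong₂ _∷_ value%2 (trans (cong (λ m → bits m d) value/2) (bits-value S))
    where
      value%2 : (bit b + value S * 2) % 2 ≡ bit b
      value%2 = trans ([m+kn]%n≡m%n (bit b) (value S) 2) (m<n⇒m%n≡m (bit<2 b))
      value/2 : (bit b + value S * 2) / 2 ≡ value S
      value/2 = ℕP.*-cancelʳ-≡ _ _ 2 (ℕP.+-cancelˡ-≡ (bit b) _ _
        (trans (cong (_+ ((bit b + value S * 2) / 2) * 2) (sym value%2))
               (sym (m≡m%n+[m/n]*n (bit b + value S * 2) 2))))

  value<2^d : ∀ {d} (S : Subset d) → value S < 2 ^ d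
  value<2^d []              = s≤s z≤n
  value<2^d {suc d} (b ∷ S) = ℕP.≤-trans (s≤s (ℕP.+-monoˡ-≤ (value S * 2) (ℕP.≤-pred (bit<2 b))))
                                         (ℕP.≤-trans (ℕP.*-monoˡ-≤ 2 (value<2^d S)) (ℕP.≤-reflexive (ℕP.*-comm (2 ^ d) 2)))

  nonempty⇒value≥1 : ∀ {d} (S : Subset d) → Nonempty S → 1 ≤ value S
  nonempty⇒value≥1 (true ∷ S)  _                  = s≤s z≤n
  nonempty⇒value≥1 (false ∷ S) (Fin.suc x , there x∈S) = ℕP.≤-trans (nonempty⇒value≥1 S (x , x∈S)) (ℕP.m≤m*n (value S) 2)

  bits-nonzero : ∀ d m → 1 ≤ m → m < 2 ^ d → ∃ λ k → lookup (bits m d) k ≡ 1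
  bits-nonzero zero    (suc m) _ (s≤s ())
  bits-nonzero (suc d) m 1≤m m<2^d with m % 2 ℕP.≟ 1
  ... | yes m%2≡1 = Fin.zero , m%2≡1
  ... | no m%2≢1  with bits-nonzero d (m / 2) 1≤m/2 m/2<2^d
    where
      m%2≡0 : m % 2 ≡ 0
      m%2≡0 with m % 2 | m%n<n m 2
      ... | 0           | _             = refl
      ... | 1           | _             = ⊥-elim (m%2≢1 refl)
      ... | suc (suc _) | s≤s (s≤s ())
      1≤m/2 : 1 ≤ m / 2
      1≤m/2 with m / 2 | m≡m%n+[m/n]*n m 2
      ... | zero  | m≡ = ⊥-elim (ℕP.<-irrefl refl (ℕP.≤-trans 1≤m (ℕP.≤-reflexive (trans m≡ (cong (_+ 0) m%2≡0)))))
      ... | suc _ | _  = s≤s z≤n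
      m/2<2^d : m / 2 < 2 ^ d
      m/2<2^d = m<n*o⇒m/o<n (ℕP.<-≤-trans m<2^d (ℕP.≤-reflexive (ℕP.*-comm 2 (2 ^ d))))
  ... | k , bitₖ≡1 = Fin.suc k , bitₖ≡1

  col-nonzero : ∀ d (c : Fin (ncols d)) → ∃ λ k → lookup (col d c) k ≡ 1
  col-nonzero d c = bits-nonzero d (suc (toℕ c)) (s≤s z≤n)
    (ℕP.≤-trans (s≤s (FinP.toℕ<n c)) (ℕP.≤-reflexive (trans (ℕP.+-comm 1 (2 ^ d ∸ 1)) (ℕP.m∸n+n≡m (ℕP.m^n>0 2 d)))))

  col-of-nonempty : ∀ d (S : Subset d) → Nonempty S → ∃ λ c → col d c ≡ map bit S
  col-of-nonempty d S nonempty = fromℕ< value-1<ncols ,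
    trans (cong (λ m → bits (suc m) d) (FinP.toℕ-fromℕ< value-1<ncols)) (trans (cong (λ m → bits m d) value-1+1) (bits-value S))
    where
      value-1<ncols : value S ∸ 1 < ncols d
      value-1<ncols = ℕP.∸-monoˡ-< (value<2^d S) (nonempty⇒value≥1 S nonempty)
      value-1+1 : suc (value S ∸ 1) ≡ value S
      value-1+1 = trans (ℕP.+-comm 1 (value S ∸ 1)) (ℕP.m∸n+n≡m (nonempty⇒value≥1 S nonempty))

  isOne : ℕ → Bool
  isOne 1 = true
  isOne _ = false

  bit-isOne : ∀ m → m < 2 → bit (isOne m) ≡ m
  bit-isOne 0 _ = refl
  bit-isOne 1 _ = refl
  bit-isOne (suc (suc _)) (s≤s (s≤s ()))

  support : ∀ {d} → Vec ℕ d → Subset d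
  support = map isOne

  bit∘support : ∀ m d → map bit (support (bits m d)) ≡ bits m d
  bit∘support m zero    = refl
  bit∘support m (suc d) = cong₂ _∷_ (bit-isOne (m % 2) (m%n<n m 2)) (bit∘support (m / 2) d)

  support-col-nonempty : ∀ d (c : Fin (ncols d)) → Nonempty (support (col d c))
  support-col-nonempty d c with col-nonzero d c
  ... | k , cₖ≡1 = k , VecP.lookup⇒[]= k (support (col d c)) (trans (VecP.lookup-map k isOne (col d c)) (cong isOne cₖ≡1))

module Rank {p : ℕ} (prime : Prime p) (d : ℕ) where

  open import Algebra.Bundles using (CommutativeRing)
  open import Data.Nat using (ℕ; zero; suc; NonZero)
  open import Data.Nat.Primality using (Prime; prime⇒nonZero)
  open import Data.Integer using (ℤ; +_; _+_; _*_; _-_; -_; 0ℤ; 1ℤ)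
  import Data.Integer.Properties as ℤP
  open import Data.Integer.Tactic.RingSolver using (solve-∀)
  import Data.Fin as Fin
  open Fin using (Fin; toℕ; punchIn)
  import Data.Fin.Properties as FinP
  open import Data.Fin.Subset using (Subset; _∈_; _∉_; ∣_∣; _⊆_; ⁅_⁆; _∪_) renaming (_-_ to _∖_)
  open import Data.Fin.Subset.Properties using (_∈?_; p─q⊆p; x∈p∧x≢y⇒x∈p-y; x≢y⇒x∉⁅y⁆; x∈⁅y⁆⇒x≡y; x∈p∪q⁻)
  open import Data.Sum using (inj₁; inj₂)
  open import Data.Vec using (Vec; []; _∷_; lookup; tabulate; map)
  open import Data.Bool using (true; false; if_then_else_)
  import Data.Vec.Properties as VecP
  open import Data.Product using (∃; _×_; _,_; proj₁; proj₂)
  open import Function using (_∘_; _⇔_; mk⇔)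
  open import Relation.Nullary using (¬_; Dec; yes; no)
  open import Relation.Nullary.Decidable using (_→-dec_; ¬?; decidable-stable)
  open import Data.Empty using (⊥-elim)
  open import Relation.Unary using (Decidable)
  open import Relation.Binary.PropositionalEquality
  open import Data.Nat.Divisibility using (_∣_)
  open Columns using (bit)
  open SubsetProperties

  private
    instance
      p≢0 : NonZero p
      p≢0 = prime⇒nonZero prime

  open Modulo p
  open CommutativeRing ℤ/p using (zeroˡ; zeroʳ; *-identityʳ; +-identityʳ; +-identityˡ)
  open import Algebra.Properties.Semiring.Sum (CommutativeRing.semiring ℤ/p)
  open import Relation.Binary.Reasoning.Setoid ≋-setoid
  open ListSum ℤP.+-*-commutativeSemiring using (𝟙; 𝟙-yes; 𝟙-no)

  n : ℕ
  n = ncols d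

  column : Fin n → Fin d → ℤ
  column c k = + lookup (col d c) k

  infix 8 _·_
  _·_ : (Fin d → ℤ) → (Fin d → ℤ) → ℤ
  w · v = ∑[ k < d ] (w k * v k)

  -- Elements of 𝔽_p are represented by Fin p and computed with through integer representatives.
  ⟦_⟧ : ∀ {m} → Vec (Fin p) m → Fin m → ℤ
  ⟦ v ⟧ k = toℤ (lookup v k)

  ⌊_⌋ : ∀ {m} → (Fin m → ℤ) → Vec (Fin p) m
  ⌊ z ⌋ = tabulate (residue ∘ z)

  ⟦⌊⌋⟧ : ∀ {m} (z : Fin m → ℤ) k → ⟦ ⌊ z ⌋ ⟧ k ≋ z k
  ⟦⌊⌋⟧ z k = ≋-trans (≋-reflexive (cong toℤ (VecP.lookup∘tabulate (residue ∘ z) k))) (toℤ-residue (z k))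

  sum-single : ∀ {m} (c : Fin m) (f : Fin m → ℤ) → (∀ i → i ≢ c → f i ≋ 0ℤ) → ∑[ i < m ] f i ≋ f c
  sum-single {suc m} c f vanish = begin
    sum f                          ≈⟨ sum-remove {i = c} f ⟩
    f c + ∑[ j < m ] f (punchIn c j) ≈⟨ +-congˡ {f c} (sum-cong-≋ (λ j → vanish _ (FinP.punchInᵢ≢i c j))) ⟩
    f c + ∑[ j < m ] 0ℤ            ≈⟨ +-congˡ {f c} (sum-replicate-zero m) ⟩
    f c + 0ℤ                       ≈⟨ +-identityʳ (f c) ⟩
    f c                            ∎

  ·-congʳ : ∀ w {v v′} → (∀ k → v k ≋ v′ k) → w · v ≋ w · v′
  ·-congʳ w v≋v′ = sum-cong-≋ (λ k → *-congˡ {w k} (v≋v′ k))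

  ·-comm : ∀ w v → w · v ≋ v · w
  ·-comm w v = sum-cong-≋ (λ k → ≋-reflexive (ℤP.*-comm (w k) (v k)))

  ·-distrib-+ : ∀ w a b → w · (λ k → a k + b k) ≋ w · a + w · b
  ·-distrib-+ w a b = ≋-trans (sum-cong-≋ (λ k → ≋-reflexive (ℤP.*-distribˡ-+ (w k) (a k) (b k))))
                              (∑-distrib-+ (λ k → w k * a k) (λ k → w k * b k))

  ·-scale : ∀ w s b → w · (λ k → s * b k) ≋ s * (w · b)
  ·-scale w s b = begin
    ∑[ k < d ] (w k * (s * b k))  ≈⟨ sum-cong-≋ (λ k → ≋-reflexive (lemma (w k) s (b k))) ⟩
    ∑[ k < d ] (s * (w k * b k))  ≈⟨ *-distribˡ-sum s (λ k → w k * b k) ⟨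
    s * (w · b)                   ∎
    where lemma : ∀ w s b → w * (s * b) ≡ s * (w * b)
          lemma = solve-∀

  ·-∑ : ∀ {m} w (s : Fin m → ℤ) (u : Fin m → Fin d → ℤ) →
        w · (λ k → ∑[ x < m ] (s x * u x k)) ≋ ∑[ x < m ] (s x * (w · u x))
  ·-∑ {m} w s u = begin
    ∑[ k < d ] (w k * ∑[ x < m ] (s x * u x k))    ≈⟨ sum-cong-≋ (λ k → *-distribˡ-sum (w k) (λ x → s x * u x k)) ⟩
    ∑[ k < d ] ∑[ x < m ] (w k * (s x * u x k))    ≈⟨ ∑-comm (λ k x → w k * (s x * u x k)) ⟩
    ∑[ x < m ] ∑[ k < d ] (w k * (s x * u x k))    ≈⟨ sum-cong-≋ (λ x → ·-scale w (s x) (u x)) ⟩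
    ∑[ x < m ] (s x * (w · u x))                   ∎

  SupportedOn : Subset n → (Fin n → ℤ) → Set
  SupportedOn T μ = ∀ x → x ∉ T → μ x ≋ 0ℤ

  IsRelation : (Fin n → ℤ) → Set
  IsRelation μ = ∀ k → ∑[ x < n ] (μ x * column x k) ≋ 0ℤ

  Independent : Subset n → Set
  Independent T = ∀ μ → SupportedOn T μ → IsRelation μ → ∀ x → μ x ≋ 0ℤ

  +-sumFin : ∀ m (f : Fin m → ℕ) → + sumFin m f ≡ ∑[ i < m ] (+ f i)
  +-sumFin zero    f = refl
  +-sumFin (suc m) f = trans (ℤP.pos-+ (f Fin.zero) _) (cong (λ z → + f Fin.zero + z) (+-sumFin m (f ∘ Fin.suc)))

  +-lincomb : ∀ λs k → + lincomb p d λs k ≡ ∑[ x < n ] (⟦ λs ⟧ x * column x k)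
  +-lincomb λs k = trans (+-sumFin n _) (sum-cong-≗ (λ x → ℤP.pos-* (toℕ (lookup λs x)) _))

  linIndep⇔independent : ∀ {T} → LinIndep p d T ⇔ Independent T
  linIndep⇔independent {T} = mk⇔ to from
    where
      to : LinIndep p d T → Independent T
      to indep μ supported relation x = begin
        μ x           ≈⟨ ⟦⌊⌋⟧ μ x ⟨
        ⟦ ⌊ μ ⌋ ⟧ x   ≡⟨ cong +_ (indep ⌊ μ ⌋ (λ y y∉T → toℤ≋0⇒≡0 (≋-trans (⟦⌊⌋⟧ μ y) (supported y y∉T))) p∣lincomb x) ⟩
        0ℤ            ∎
        where
          p∣lincomb : ∀ k → p ∣ lincomb p d ⌊ μ ⌋ k
          p∣lincomb k = ≋0⇒∣ (begin
            + lincomb p d ⌊ μ ⌋ k               ≡⟨ +-lincomb ⌊ μ ⌋ k ⟩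
            ∑[ x < n ] (⟦ ⌊ μ ⌋ ⟧ x * column x k) ≈⟨ sum-cong-≋ (λ x → *-congʳ (⟦⌊⌋⟧ μ x)) ⟩
            ∑[ x < n ] (μ x * column x k)         ≈⟨ relation k ⟩
            0ℤ                                    ∎)
      from : Independent T → LinIndep p d T
      from indep λs supported p∣lincomb x = toℤ≋0⇒≡0 (indep ⟦ λs ⟧
        (λ y y∉T → ≋-reflexive (cong +_ (supported y y∉T)))
        (λ k → subst (_≋ 0ℤ) (+-lincomb λs k) (∣⇒≋0 (p∣lincomb k))) x)

  Orthogonal : Fin n → Vec (Fin p) d → Set
  Orthogonal c v = column c · ⟦ v ⟧ ≋ 0ℤ

  orthogonal? : ∀ c → Decidable (Orthogonal c)
  orthogonal? c v = ≋0? (column c · ⟦ v ⟧)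

  Solution : Subset n → Vec (Fin p) d → Set
  Solution T v = ∀ c → c ∈ T → Orthogonal c v

  solution? : ∀ T → Decidable (Solution T)
  solution? T v = allFin? (λ c → (c ∈? T) →-dec orthogonal? c v)

  solutions : Subset n → ℕ
  solutions T = count (solution? T) (allFinVecs p d)

  record DualBasis (T : Subset n) : Set where
    field
      dual      : Fin n → Fin d → ℤ
      dual-diag : ∀ {c} → c ∈ T → column c · dual c ≋ 1ℤ
      dual-off  : ∀ {c c′} → c ∈ T → c′ ∈ T → c′ ≢ c → column c′ · dual c ≋ 0ℤ

  DualVector : Fin n → Subset n → (Fin d → ℤ) → Set
  DualVector c T w = column c · w ≋ 1ℤ × (∀ {c′} → c′ ∈ T → column c′ · w ≋ 0ℤ)

  ·-𝟙 : ∀ w k → w · (λ j → 𝟙 (j FinP.≟ k)) ≋ w k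
  ·-𝟙 w k = begin
    ∑[ j < d ] (w j * 𝟙 (j FinP.≟ k))  ≈⟨ sum-single k _ vanish ⟩
    w k * 𝟙 (k FinP.≟ k)               ≡⟨ cong (w k *_) (𝟙-yes (k FinP.≟ k) refl) ⟩
    w k * 1ℤ                           ≈⟨ *-identityʳ (w k) ⟩
    w k                                ∎
    where
      vanish : ∀ j → j ≢ k → w j * 𝟙 (j FinP.≟ k) ≋ 0ℤ
      vanish j j≢k = ≋-reflexive (trans (cong (w j *_) (𝟙-no (j FinP.≟ k) j≢k)) (ℤP.*-zeroʳ (w j)))

  dualVector-by-scaling : ∀ {c T} v → ¬ column c · v ≋ 0ℤ → (∀ {c′} → c′ ∈ T → column c′ · v ≋ 0ℤ) →
                          ∃ (DualVector c T)
  dualVector-by-scaling {c} {T} v c·v≉0 orthogonal = scale (inverse prime (column c · v) c·v≉0)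
    where
      scale : ∃ (λ b → column c · v * b ≋ 1ℤ) → ∃ (DualVector c T)
      scale (b , c·v*b≋1) = (λ j → b * v j) , (begin
          column c · (λ j → b * v j)  ≈⟨ ·-scale (column c) b v ⟩
          b * (column c · v)          ≡⟨ ℤP.*-comm b _ ⟩
          column c · v * b            ≈⟨ c·v*b≋1 ⟩
          1ℤ                          ∎)
        , λ {c′} c′∈T → begin
          column c′ · (λ j → b * v j)  ≈⟨ ·-scale (column c′) b v ⟩
          b * (column c′ · v)          ≈⟨ *-congˡ {b} (orthogonal c′∈T) ⟩
          b * 0ℤ                       ≈⟨ zeroʳ b ⟩
          0ℤ                           ∎

  module Projection {T′ : Subset n} (basis : DualBasis T′) where

    open DualBasis basis

    g : Fin d → Fin n → ℤ
    g k x = 𝟙 (x ∈? T′) * column x k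

    -- z k is the k-th unit vector minus its components along the columns of T′.
    z : Fin d → Fin d → ℤ
    z k j = 𝟙 (j FinP.≟ k) + ∑[ x < n ] (- g k x * dual x j)

    ·-z : ∀ w k → w · z k ≋ w k + ∑[ x < n ] (- g k x * (w · dual x))
    ·-z w k = ≋-trans (·-distrib-+ w _ _) (≋-+-cong (·-𝟙 w k) (·-∑ w (λ x → - g k x) dual))

    z-orthogonal : ∀ k {c′} → c′ ∈ T′ → column c′ · z k ≋ 0ℤ
    z-orthogonal k {c′} c′∈T′ = begin
      column c′ · z k                                            ≈⟨ ·-z (column c′) k ⟩
      column c′ k + ∑[ x < n ] (- g k x * (column c′ · dual x))  ≈⟨ +-congˡ {column c′ k} (sum-single c′ _ vanish) ⟩
      column c′ k + - g k c′ * (column c′ · dual c′)             ≈⟨ +-congˡ {column c′ k} (*-congˡ { - g k c′ } (dual-diag c′∈T′)) ⟩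
      column c′ k + - g k c′ * 1ℤ                                ≡⟨ cong (λ e → column c′ k + - (e * column c′ k) * 1ℤ) (𝟙-yes (c′ ∈? T′) c′∈T′) ⟩
      column c′ k + - (1ℤ * column c′ k) * 1ℤ                    ≡⟨ lemma (column c′ k) ⟩
      0ℤ                                                         ∎
      where
        lemma : ∀ a → a + - (1ℤ * a) * 1ℤ ≡ 0ℤ
        lemma = solve-∀
        vanish : ∀ x → x ≢ c′ → - g k x * (column c′ · dual x) ≋ 0ℤ
        vanish x x≢c′ with x ∈? T′
        ... | yes x∈T′ = ≋-trans (*-congˡ { - (1ℤ * column x k) } (dual-off x∈T′ c′∈T′ (x≢c′ ∘ sym))) (zeroʳ (- (1ℤ * column x k)))
        ... | no _     = ≋-reflexive (trans (cong (λ e → - e * (column c′ · dual x)) (ℤP.*-zeroˡ (column x k)))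
                                            (ℤP.*-zeroˡ (column c′ · dual x)))

  independent⇒¬projections-orthogonal : ∀ {T c} → Independent T → c ∈ T → (basis : DualBasis (T ∖ c)) →
                           ¬ (∀ k → column c · Projection.z basis k ≋ 0ℤ)
  -- Otherwise column c = Σ_{x ∈ T ∖ c} (column c · dual x) · column x, a non-trivial relation μ on T.
  independent⇒¬projections-orthogonal {T} {c} independent c∈T basis c·z≋0 =
    1≉0 prime (≋-trans (≋-sym μc≋1) (independent μ supported relation c))
    where
      open DualBasis basis
      open Projection basis
      T′ = T ∖ c

      μ : Fin n → ℤ
      μ x = 𝟙 (x FinP.≟ c) + - 𝟙 (x ∈? T′) * (column c · dual x)

      μc≋1 : μ c ≋ 1ℤ
      μc≋1 = ≋-reflexive (cong₂ (λ e f → e + - f * (column c · dual c))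
                                (𝟙-yes (c FinP.≟ c) refl) (𝟙-no (c ∈? T′) (x∉p-x T c)))

      supported : SupportedOn T μ
      supported x x∉T = ≋-reflexive (cong₂ (λ e f → e + - f * (column c · dual x))
        (𝟙-no (x FinP.≟ c) (λ { refl → x∉T c∈T })) (𝟙-no (x ∈? T′) (x∉T ∘ p─q⊆p T ⁅ c ⁆)))

      relation : IsRelation μ
      relation k = begin
        ∑[ x < n ] (μ x * column x k)                                    ≈⟨ sum-cong-≋ (λ x → ≋-reflexive (lemma (𝟙 (x FinP.≟ c)) (column x k) (𝟙 (x ∈? T′)) (column c · dual x))) ⟩
        ∑[ x < n ] (𝟙 (x FinP.≟ c) * column x k + - g k x * (column c · dual x))  ≈⟨ ∑-distrib-+ (λ x → 𝟙 (x FinP.≟ c) * column x k) (λ x → - g k x * (column c · dual x)) ⟩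
        ∑[ x < n ] (𝟙 (x FinP.≟ c) * column x k) + ∑[ x < n ] (- g k x * (column c · dual x))
                                                                         ≈⟨ +-congʳ (sum-single c _ vanish) ⟩
        𝟙 (c FinP.≟ c) * column c k + ∑[ x < n ] (- g k x * (column c · dual x))
                                                                         ≡⟨ cong (λ e → e * column c k + rest) (𝟙-yes (c FinP.≟ c) refl) ⟩
        1ℤ * column c k + ∑[ x < n ] (- g k x * (column c · dual x))     ≡⟨ cong (_+ rest) (ℤP.*-identityˡ (column c k)) ⟩
        column c k + ∑[ x < n ] (- g k x * (column c · dual x))          ≈⟨ ·-z (column c) k ⟨
        column c · z k                                                   ≈⟨ c·z≋0 k ⟩
        0ℤ                                                               ∎
        where
          rest = ∑[ x < n ] (- g k x * (column c · dual x))
          lemma : ∀ e a f s → (e + - f * s) * a ≡ e * a + - (f * a) * s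
          lemma = solve-∀
          vanish : ∀ x → x ≢ c → 𝟙 (x FinP.≟ c) * column x k ≋ 0ℤ
          vanish x x≢c = ≋-reflexive (trans (cong (_* column x k) (𝟙-no (x FinP.≟ c) x≢c)) (ℤP.*-zeroˡ (column x k)))

  dualVector-of-independent : ∀ {T c} → Independent T → c ∈ T → DualBasis (T ∖ c) → ∃ (DualVector c (T ∖ c))
  dualVector-of-independent {T} {c} independent c∈T basis =
    from-search (FinP.any? (λ k → ¬? (≋0? (column c · z k))))
    where
      open Projection basis
      from-search : Dec (∃ λ k → ¬ column c · z k ≋ 0ℤ) → ∃ (DualVector c (T ∖ c))
      from-search (yes (k , c·zₖ≉0)) = dualVector-by-scaling (z k) c·zₖ≉0 (z-orthogonal k)
      from-search (no none) = ⊥-elim (independent⇒¬projections-orthogonal independent c∈T basis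
        (λ k → decidable-stable (≋0? _) (λ c·zₖ≉0 → none (k , c·zₖ≉0))))

  translate : (Fin d → ℤ) → Vec (Fin p) d → Vec (Fin p) d
  translate s v = ⌊ (λ k → ⟦ v ⟧ k + s k) ⌋

  ·-translate : ∀ w s v → w · ⟦ translate s v ⟧ ≋ w · ⟦ v ⟧ + w · s
  ·-translate w s v = ≋-trans (·-congʳ w (⟦⌊⌋⟧ (λ k → ⟦ v ⟧ k + s k))) (·-distrib-+ w ⟦ v ⟧ s)

  translate-inverse : ∀ s s′ → (∀ k → s k + s′ k ≋ 0ℤ) → ∀ v → translate s′ (translate s v) ≡ v
  translate-inverse s s′ s+s′≋0 v = trans (VecP.tabulate-cong coordinate) (VecP.tabulate∘lookup v)
    where
      coordinate : ∀ k → residue (⟦ translate s v ⟧ k + s′ k) ≡ lookup v k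
      coordinate k = trans (residue-cong (begin
        ⟦ translate s v ⟧ k + s′ k     ≈⟨ +-congʳ (⟦⌊⌋⟧ (λ k → ⟦ v ⟧ k + s k) k) ⟩
        ⟦ v ⟧ k + s k + s′ k           ≡⟨ ℤP.+-assoc (⟦ v ⟧ k) (s k) (s′ k) ⟩
        ⟦ v ⟧ k + (s k + s′ k)         ≈⟨ +-congˡ {⟦ v ⟧ k} (s+s′≋0 k) ⟩
        ⟦ v ⟧ k + 0ℤ                   ≡⟨ ℤP.+-identityʳ (⟦ v ⟧ k) ⟩
        ⟦ v ⟧ k                        ∎)) (residue-toℤ (lookup v k))

  module _ {T c w} (c∈T : c ∈ T) (dualVector : DualVector c (T ∖ c) w) (t : Fin p) where

    private
      c·w≋1 = proj₁ dualVector
      c′·w≋0 = proj₂ dualVector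
      shift = translate (λ k → - toℤ t * w k)

      ·-shift : ∀ x v → column x · ⟦ shift v ⟧ ≋ column x · ⟦ v ⟧ + - toℤ t * (column x · w)
      ·-shift x v = ≋-trans (·-translate (column x) _ v) (+-congˡ {column x · ⟦ v ⟧} (·-scale (column x) (- toℤ t) w))

      ·-shift-∖ : ∀ {x} v → x ∈ T ∖ c → column x · ⟦ shift v ⟧ ≋ column x · ⟦ v ⟧
      ·-shift-∖ {x} v x∈T∖c = begin
        column x · ⟦ shift v ⟧                   ≈⟨ ·-shift x v ⟩
        column x · ⟦ v ⟧ + - toℤ t * (column x · w) ≈⟨ +-congˡ {column x · ⟦ v ⟧} (*-congˡ { - toℤ t } (c′·w≋0 x∈T∖c)) ⟩
        column x · ⟦ v ⟧ + - toℤ t * 0ℤ          ≡⟨ cong (λ e → column x · ⟦ v ⟧ + e) (ℤP.*-zeroʳ (- toℤ t)) ⟩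
        column x · ⟦ v ⟧ + 0ℤ                    ≡⟨ ℤP.+-identityʳ _ ⟩
        column x · ⟦ v ⟧                         ∎

      ·-shift-c : ∀ v → column c · ⟦ shift v ⟧ ≋ column c · ⟦ v ⟧ - toℤ t
      ·-shift-c v = begin
        column c · ⟦ shift v ⟧                      ≈⟨ ·-shift c v ⟩
        column c · ⟦ v ⟧ + - toℤ t * (column c · w) ≈⟨ +-congˡ {column c · ⟦ v ⟧} (*-congˡ { - toℤ t } c·w≋1) ⟩
        column c · ⟦ v ⟧ + - toℤ t * 1ℤ             ≡⟨ cong (λ e → column c · ⟦ v ⟧ + e) (ℤP.*-identityʳ (- toℤ t)) ⟩
        column c · ⟦ v ⟧ - toℤ t                    ∎

    fiber⇔translate : ∀ v → (Solution (T ∖ c) v × t ≡ residue (column c · ⟦ v ⟧)) ⇔ Solution T (shift v)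
    fiber⇔translate v = mk⇔ to from
      where
        to : Solution (T ∖ c) v × t ≡ residue (column c · ⟦ v ⟧) → Solution T (shift v)
        to (solution , refl) x x∈T with x FinP.≟ c
        ... | yes refl = ≋-trans (·-shift-c v) (≋-trans (+-congˡ {column c · ⟦ v ⟧} (≋-neg-cong (toℤ-residue _)))
                                                        (≋-reflexive (ℤP.+-inverseʳ (column c · ⟦ v ⟧))))
        ... | no x≢c   = ≋-trans (·-shift-∖ v (x∈p∧x≢y⇒x∈p-y x∈T x≢c)) (solution x (x∈p∧x≢y⇒x∈p-y x∈T x≢c))
        from : Solution T (shift v) → Solution (T ∖ c) v × t ≡ residue (column c · ⟦ v ⟧)
        from solution =
          (λ x x∈T∖c → ≋-trans (≋-sym (·-shift-∖ v x∈T∖c)) (solution x (p─q⊆p T ⁅ c ⁆ x∈T∖c))) ,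
          trans (sym (residue-toℤ t)) (residue-cong (begin
            toℤ t                                  ≡⟨ lemma (column c · ⟦ v ⟧) (toℤ t) ⟩
            column c · ⟦ v ⟧ - (column c · ⟦ v ⟧ - toℤ t) ≈⟨ +-congˡ {column c · ⟦ v ⟧} (≋-neg-cong (≋-trans (≋-sym (·-shift-c v)) (solution c c∈T))) ⟩
            column c · ⟦ v ⟧ - 0ℤ                  ≡⟨ ℤP.+-identityʳ _ ⟩
            column c · ⟦ v ⟧                       ∎))
          where lemma : ∀ a t → t ≡ a - (a - t)
                lemma = solve-∀

  -- The new dual vectors are the old ones corrected along w, so that column c annihilates them.
  module DualBasisExtension {T c w} (c∈T : c ∈ T) (basis : DualBasis (T ∖ c)) (dualVector : DualVector c (T ∖ c) w) where

    open DualBasis basis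

    private
      c·w≋1 = proj₁ dualVector
      c′·w≋0 = proj₂ dualVector

    dual′ : Fin n → Fin d → ℤ
    dual′ x with x FinP.≟ c
    ... | yes _ = w
    ... | no _  = λ k → dual x k + - (column c · dual x) * w k

    ·-dual′ : ∀ y {x} → x ≢ c → column y · dual′ x ≋ column y · dual x + - (column c · dual x) * (column y · w)
    ·-dual′ y {x} x≢c with x FinP.≟ c
    ... | yes x≡c = ⊥-elim (x≢c x≡c)
    ... | no _    = ≋-trans (·-distrib-+ (column y) (dual x) _)
                            (+-congˡ {column y · dual x} (·-scale (column y) (- (column c · dual x)) w))

    dual′-c : dual′ c ≡ w
    dual′-c with c FinP.≟ c
    ... | yes _   = refl
    ... | no c≢c  = ⊥-elim (c≢c refl)

    dual′-diag : ∀ {x} → x ∈ T → column x · dual′ x ≋ 1ℤ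
    dual′-diag {x} x∈T = by-cases (x FinP.≟ c)
      where
        by-cases : Dec (x ≡ c) → column x · dual′ x ≋ 1ℤ
        by-cases (yes refl) = ≋-trans (≋-reflexive (cong (column c ·_) dual′-c)) c·w≋1
        by-cases (no x≢c)   = begin
          column x · dual′ x                                            ≈⟨ ·-dual′ x x≢c ⟩
          column x · dual x + - (column c · dual x) * (column x · w)  ≈⟨ ≋-+-cong (dual-diag x∈T∖c) (*-congˡ { - (column c · dual x) } (c′·w≋0 x∈T∖c)) ⟩
          1ℤ + - (column c · dual x) * 0ℤ                             ≡⟨ cong (λ e → 1ℤ + e) (ℤP.*-zeroʳ (- (column c · dual x))) ⟩
          1ℤ                                                          ∎
          where x∈T∖c = x∈p∧x≢y⇒x∈p-y x∈T x≢c

    dual′-off : ∀ {x y} → x ∈ T → y ∈ T → y ≢ x → column y · dual′ x ≋ 0ℤ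
    dual′-off {x} {y} x∈T y∈T y≢x = by-cases (x FinP.≟ c) (y FinP.≟ c)
      where
        by-cases : Dec (x ≡ c) → Dec (y ≡ c) → column y · dual′ x ≋ 0ℤ
        by-cases (yes refl) _ = ≋-trans (≋-reflexive (cong (column y ·_) dual′-c)) (c′·w≋0 (x∈p∧x≢y⇒x∈p-y y∈T y≢x))
        by-cases (no x≢c) (yes refl) = begin
          column c · dual′ x                                            ≈⟨ ·-dual′ c x≢c ⟩
          column c · dual x + - (column c · dual x) * (column c · w)  ≈⟨ +-congˡ {column c · dual x} (*-congˡ { - (column c · dual x) } c·w≋1) ⟩
          column c · dual x + - (column c · dual x) * 1ℤ              ≡⟨ lemma (column c · dual x) ⟩
          0ℤ                                                          ∎
          where lemma : ∀ a → a + - a * 1ℤ ≡ 0ℤ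
                lemma = solve-∀
        by-cases (no x≢c) (no y≢c) = begin
          column y · dual′ x                                            ≈⟨ ·-dual′ y x≢c ⟩
          column y · dual x + - (column c · dual x) * (column y · w)  ≈⟨ ≋-+-cong (dual-off x∈T∖c y∈T∖c y≢x) (*-congˡ { - (column c · dual x) } (c′·w≋0 y∈T∖c)) ⟩
          0ℤ + - (column c · dual x) * 0ℤ                             ≡⟨ trans (ℤP.+-identityˡ _) (ℤP.*-zeroʳ (- (column c · dual x))) ⟩
          0ℤ                                                          ∎
          where x∈T∖c = x∈p∧x≢y⇒x∈p-y x∈T x≢c
                y∈T∖c = x∈p∧x≢y⇒x∈p-y y∈T y≢c

  dualBasis-extend : ∀ {T c w} → c ∈ T → DualBasis (T ∖ c) → DualVector c (T ∖ c) w → DualBasis T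
  dualBasis-extend c∈T basis dualVector = record { dual = dual′ ; dual-diag = dual′-diag ; dual-off = dual′-off }
    where open DualBasisExtension c∈T basis dualVector

  independent-⊆ : ∀ {S T} → S ⊆ T → Independent T → Independent S
  independent-⊆ S⊆T independent μ supported = independent μ (λ x x∉T → supported x (x∉T ∘ S⊆T))

  ·-zeroʳ : ∀ w → w · (λ _ → 0ℤ) ≋ 0ℤ
  ·-zeroʳ w = ≋-trans (sum-cong-≋ (λ k → zeroʳ (w k))) (sum-replicate-zero d)

  zero-solution : ∀ T → Solution T ⌊ (λ _ → 0ℤ) ⌋
  zero-solution T c _ = ≋-trans (·-congʳ (column c) (⟦⌊⌋⟧ (λ _ → 0ℤ))) (·-zeroʳ (column c))

  independent-⁅⁆ : ∀ {c k} → lookup (col d c) k ≡ 1 → Independent ⁅ c ⁆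
  independent-⁅⁆ {c} {k} cₖ≡1 μ supported relation x with x FinP.≟ c
  ... | no x≢c   = supported x (x≢y⇒x∉⁅y⁆ x≢c)
  ... | yes refl = begin
    μ x                           ≡⟨ ℤP.*-identityʳ (μ x) ⟨
    μ x * 1ℤ                      ≡⟨ cong (λ e → μ x * + e) cₖ≡1 ⟨
    μ x * column x k              ≈⟨ sum-single x (λ y → μ y * column y k) vanish ⟨
    ∑[ y < n ] (μ y * column y k) ≈⟨ relation k ⟩
    0ℤ                            ∎
    where
      vanish : ∀ y → y ≢ x → μ y * column y k ≋ 0ℤ
      vanish y y≢x = ≋-trans (*-congʳ (supported y (x≢y⇒x∉⁅y⁆ y≢x))) (zeroˡ (column y k))

  independent-∪ : ∀ {B c v} → Solution B v → ¬ Orthogonal c v → Independent B → Independent (⁅ c ⁆ ∪ B)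
  independent-∪ {B} {c} {v} solution c·v≉0 independent μ supported relation =
    independent μ supportedB relation
    where
      outside : ∀ {x} → x ≢ c → x ∉ B → x ∉ ⁅ c ⁆ ∪ B
      outside x≢c x∉B x∈⁅c⁆∪B with x∈p∪q⁻ ⁅ c ⁆ B x∈⁅c⁆∪B
      ... | inj₁ x∈⁅c⁆ = x≢c (x∈⁅y⁆⇒x≡y c x∈⁅c⁆)
      ... | inj₂ x∈B   = x∉B x∈B

      vanish : ∀ x → x ≢ c → μ x * (column x · ⟦ v ⟧) ≋ 0ℤ
      vanish x x≢c with x ∈? B
      ... | yes x∈B = ≋-trans (*-congˡ {μ x} (solution x x∈B)) (zeroʳ (μ x))
      ... | no x∉B  = ≋-trans (*-congʳ (supported x (outside x≢c x∉B))) (zeroˡ (column x · ⟦ v ⟧))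

      μc≋0 : μ c ≋ 0ℤ
      μc≋0 = cancel-unitˡ prime c·v≉0 (begin
        column c · ⟦ v ⟧ * μ c                       ≡⟨ ℤP.*-comm _ (μ c) ⟩
        μ c * (column c · ⟦ v ⟧)                     ≈⟨ sum-single c (λ x → μ x * (column x · ⟦ v ⟧)) vanish ⟨
        ∑[ x < n ] (μ x * (column x · ⟦ v ⟧))        ≈⟨ sum-cong-≋ (λ x → *-congˡ {μ x} (·-comm (column x) ⟦ v ⟧)) ⟩
        ∑[ x < n ] (μ x * (⟦ v ⟧ · column x))        ≈⟨ ·-∑ ⟦ v ⟧ μ column ⟨
        ⟦ v ⟧ · (λ k → ∑[ x < n ] (μ x * column x k)) ≈⟨ ·-congʳ ⟦ v ⟧ relation ⟩
        ⟦ v ⟧ · (λ _ → 0ℤ)                           ≈⟨ ·-zeroʳ ⟦ v ⟧ ⟩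
        0ℤ                                           ∎)

      supportedB : SupportedOn B μ
      supportedB x x∉B with x FinP.≟ c
      ... | yes refl = μc≋0
      ... | no x≢c   = supported x (outside x≢c x∉B)

  +-selSum : ∀ {m} (S : Subset m) (v : Vec (Fin p) m) → + selSum S v ≡ ∑[ k < m ] (+ bit (lookup S k) * ⟦ v ⟧ k)
  +-selSum []      []      = refl
  +-selSum (b ∷ S) (x ∷ v) = trans (ℤP.pos-+ _ (selSum S v)) (cong₂ _+_ (selected b) (+-selSum S v))
    where
      selected : ∀ b → + (if b then toℕ x else 0) ≡ + bit b * toℤ x
      selected true  = sym (ℤP.*-identityˡ (toℤ x))
      selected false = sym (ℤP.*-zeroˡ (toℤ x))

  selSum-column : ∀ {S c} → col d c ≡ map bit S → ∀ v → + selSum S v ≡ column c · ⟦ v ⟧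
  selSum-column {S} {c} col≡S v = trans (+-selSum S v) (sum-cong-≗ λ k →
    cong (λ b → + b * ⟦ v ⟧ k) (trans (sym (VecP.lookup-map k bit S)) (cong (λ w → lookup w k) (sym col≡S))))

module SolutionCount {p : ℕ} (prime : Prime p) (d : ℕ) where

  open import Data.Nat as ℕ using (ℕ; zero; suc; _+_; _*_; _^_; _∸_; _≤_; NonZero)
  import Data.Nat.Properties as ℕP
  open import Data.Nat.Primality using (Prime; prime⇒nonZero; prime⇒nonTrivial)
  open import Data.Fin using (Fin)
  import Data.Fin.Properties as FinP
  open import Data.Fin.Subset using (Subset; _∈_; _∉_; ∣_∣; _⊆_; ⁅_⁆; _∪_; ⊥) renaming (_-_ to _∖_)
  open import Data.Fin.Subset.Properties
    using (_⊆?_; p─q⊆p; x∈⁅y⁆⇒x≡y; ∣⁅x⁆∣≡1; p⊂q⇒∣p∣<∣q∣; ⊥⊆; ∉⊥; ∣⊥∣≡0)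
  open import Data.Vec using (Vec; _∷_)
  import Data.Vec.Properties as VecP
  open import Data.List using (List; _∷_; map; filter; length; allFin)
  import Data.List.Properties as ListP
  open import Data.List.Membership.Propositional using () renaming (_∈_ to _∈ˡ_)
  open import Data.List.Membership.Propositional.Properties using (∈-map⁻; ∈-filter⁻; ∈-map⁺; ∈-filter⁺)
  import Data.List.Relation.Unary.Any as Any
  open import Data.Product using (∃; _×_; _,_; proj₁; proj₂)
  open import Data.Sum using (_⊎_; inj₁; inj₂)
  import Data.Empty
  open Data.Empty using (⊥-elim)
  open import Function using (_∘_; Equivalence)
  open import Relation.Nullary using (¬_; yes; no)
  open import Relation.Unary using (Decidable)
  open import Relation.Nullary.Decidable using (_×-dec_; decidable-stable)
  open import Relation.Binary.PropositionalEquality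
  import Data.Integer as ℤ
  open import Data.Integer.Tactic.RingSolver using (solve-∀)
  open ListSum ℕP.+-*-commutativeSemiring using (∑; ∑-cong)
  open Counting
  open SubsetProperties
  open Columns using (col-nonzero)

  open Rank prime d
  open Modulo p using (residue; toℤ; ≋-reflexive)

  private
    instance
      p≢0 : NonZero p
      p≢0 = prime⇒nonZero prime

  -- Split the solutions of T ∖ c by the value t of column c · v; translation by −t·w maps the
  -- part over t bijectively onto the solutions of T.
  solutions-∖ : ∀ {T c w} → c ∈ T → DualVector c (T ∖ c) w → solutions (T ∖ c) ≡ p * solutions T
  solutions-∖ {T} {c} {w} c∈T dualVector = begin
    solutions (T ∖ c)                                                      ≡⟨ count-partition FinP._≟_ (allFin p) (allFin-enumerates p) (solution? (T ∖ c)) key V ⟩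
    ∑[ t ∈ allFin p ] count (λ v → solution? (T ∖ c) v ×-dec (t FinP.≟ key v)) V
      ≡⟨ ∑-cong (allFin p) (λ t → count-cong _ (solution? T ∘ shift t) (λ {v} → Equivalence.to (fiber⇔translate c∈T dualVector t v))
                                                                       (λ {v} → Equivalence.from (fiber⇔translate c∈T dualVector t v)) V) ⟩
    ∑[ t ∈ allFin p ] count (solution? T ∘ shift t) V                     ≡⟨ ∑-cong (allFin p) (λ t → count-∘-bijection (VecP.≡-dec FinP._≟_) (solution? T) V (shift t) (unshift t)
                                                                               (translate-inverse (λ k → ℤ.- toℤ t ℤ.* w k) (λ k → toℤ t ℤ.* w k) (λ k → ≋-reflexive (lemma (toℤ t) (w k))))
                                                                               (translate-inverse (λ k → toℤ t ℤ.* w k) (λ k → ℤ.- toℤ t ℤ.* w k) (λ k → ≋-reflexive (lemma′ (toℤ t) (w k))))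
                                                                               (allVecs-enumerates FinP._≟_ (allFin p) (allFin-enumerates p) d)) ⟩
    ∑[ t ∈ allFin p ] solutions T                                          ≡⟨ ∑-const (allFin p) (solutions T) ⟩
    length (allFin p) * solutions T                                        ≡⟨ cong (_* solutions T) (ListP.length-tabulate {n = p} (λ i → i)) ⟩
    p * solutions T                                                        ∎
    where
      open ≡-Reasoning
      V = allFinVecs p d
      key : Vec (Fin p) d → Fin p
      key v = residue (column c · ⟦ v ⟧)
      shift unshift : Fin p → Vec (Fin p) d → Vec (Fin p) d
      shift t = translate (λ k → ℤ.- toℤ t ℤ.* w k)
      unshift t = translate (λ k → toℤ t ℤ.* w k)
      lemma : ∀ t w → ℤ.- t ℤ.* w ℤ.+ t ℤ.* w ≡ ℤ.0ℤ
      lemma = solve-∀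
      lemma′ : ∀ t w → t ℤ.* w ℤ.+ ℤ.- t ℤ.* w ≡ ℤ.0ℤ
      lemma′ = solve-∀

  solutions-empty : ∀ {T} → (∀ {c} → c ∉ T) → solutions T ≡ p ^ d
  solutions-empty {T} empty = begin
    solutions T               ≡⟨ count≡length (solution? T) (λ v c c∈T → ⊥-elim (empty c∈T)) (allFinVecs p d) ⟩
    length (allFinVecs p d)   ≡⟨ length-allVecs (allFin p) d ⟩
    length (allFin p) ^ d     ≡⟨ cong (_^ d) (ListP.length-tabulate {n = p} (λ i → i)) ⟩
    p ^ d                     ∎
    where open ≡-Reasoning

  independent⇒solutions : ∀ m {T} → ∣ T ∣ ≡ m → Independent T → solutions T * p ^ m ≡ p ^ d × DualBasis T
  independent⇒solutions zero {T} ∣T∣≡0 _ =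
    trans (ℕP.*-identityʳ (solutions T)) (solutions-empty (∣p∣≡0⇒x∉p ∣T∣≡0)) ,
    record { dual = λ _ _ → ℤ.0ℤ ; dual-diag = ⊥-elim ∘ ∣p∣≡0⇒x∉p ∣T∣≡0 ; dual-off = λ c∈T _ _ → ⊥-elim (∣p∣≡0⇒x∉p ∣T∣≡0 c∈T) }
  independent⇒solutions (suc m) {T} ∣T∣≡1+m independent = step (∣p∣≡1+m⇒nonempty ∣T∣≡1+m)
    where
      step : (∃ λ c → c ∈ T) → solutions T * p ^ suc m ≡ p ^ d × DualBasis T
      step (c , c∈T) = extend (independent⇒solutions m (ℕP.suc-injective (trans (x∈p⇒∣p-x∣+1≡∣p∣ c∈T) ∣T∣≡1+m))
                                                     (independent-⊆ (p─q⊆p T ⁅ c ⁆) independent))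
        where
          extend : solutions (T ∖ c) * p ^ m ≡ p ^ d × DualBasis (T ∖ c) → solutions T * p ^ suc m ≡ p ^ d × DualBasis T
          extend (count , basis) = dualVector-step (dualVector-of-independent independent c∈T basis)
            where
              dualVector-step : ∃ (DualVector c (T ∖ c)) → solutions T * p ^ suc m ≡ p ^ d × DualBasis T
              dualVector-step (w , dualVector) = (begin
                solutions T * (p * p ^ m)     ≡⟨ ℕP.*-assoc (solutions T) p (p ^ m) ⟨
                solutions T * p * p ^ m       ≡⟨ cong (_* p ^ m) (ℕP.*-comm (solutions T) p) ⟩
                p * solutions T * p ^ m       ≡⟨ cong (_* p ^ m) (solutions-∖ c∈T dualVector) ⟨
                solutions (T ∖ c) * p ^ m     ≡⟨ count ⟩
                p ^ d                         ∎) , dualBasis-extend c∈T basis dualVector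
                where open ≡-Reasoning

  IndependentIn : Subset n → Subset n → Set
  IndependentIn S T = T ⊆ S × LinIndep p d T

  independentIn? : ∀ S → Decidable (IndependentIn S)
  independentIn? S T = (T ⊆? S) ×-dec linIndep? p d T

  spanDim-upper : ∀ {S B} → B ⊆ S → LinIndep p d B → ∣ B ∣ ≤ spanDim p d S
  spanDim-upper {S} {B} B⊆S independent =
    max-upper (∈-map⁺ ∣_∣ (∈-filter⁺ (independentIn? S) (allSubsets-complete B) (B⊆S , independent)))

  spanDim-attained : ∀ S → ∃ λ B → IndependentIn S B × ∣ B ∣ ≡ spanDim p d S
  spanDim-attained S = from-max (max-attained (map ∣_∣ candidates))
    where
      candidates = filter (independentIn? S) (allSubsets n)
      from-max : spanDim p d S ≡ 0 ⊎ spanDim p d S ∈ˡ map ∣_∣ candidates → ∃ λ B → IndependentIn S B × ∣ B ∣ ≡ spanDim p d S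
      from-max (inj₁ r≡0) = ⊥ , (⊥⊆ , λ λs outside _ c → outside c ∉⊥) , trans (∣⊥∣≡0 n) (sym r≡0)
      from-max (inj₂ r∈)  with ∈-map⁻ ∣_∣ r∈
      ... | B , B∈candidates , r≡∣B∣ = B , proj₂ (∈-filter⁻ (independentIn? S) {xs = allSubsets n} B∈candidates) , sym r≡∣B∣

  solutions-basis : ∀ {S B} → IndependentIn S B → ∣ B ∣ ≡ spanDim p d S → solutions S ≡ solutions B
  solutions-basis {S} {B} (B⊆S , independent) maximal =
    count-cong (solution? S) (solution? B) (λ {v} solution c c∈B → solution c (B⊆S c∈B)) (λ {v} → extend {v}) (allFinVecs p d)
    where
      extend : ∀ {v} → Solution B v → Solution S v
      extend {v} solution c c∈S = decidable-stable (orthogonal? c v) not-orthogonal⇒⊥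
        where
          not-orthogonal⇒⊥ : ¬ Orthogonal c v → Data.Empty.⊥
          not-orthogonal⇒⊥ c·v≉0 = ℕP.<-irrefl refl (begin-strict
            ∣ B ∣              <⟨ p⊂q⇒∣p∣<∣q∣ (p⊂⁅x⁆∪p (λ c∈B → c·v≉0 (solution c c∈B))) ⟩
            ∣ ⁅ c ⁆ ∪ B ∣      ≤⟨ spanDim-upper (⁅x⁆∪p⊆q c∈S B⊆S) (Equivalence.from linIndep⇔independent
                                    (independent-∪ {v = v} solution c·v≉0 (Equivalence.to linIndep⇔independent independent))) ⟩
            spanDim p d S      ≡⟨ maximal ⟨
            ∣ B ∣              ∎)
            where open ℕP.≤-Reasoning

  rank-count : ∀ S → solutions S * p ^ spanDim p d S ≡ p ^ d
  rank-count S = from-basis (spanDim-attained S)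
    where
      from-basis : ∃ (λ B → IndependentIn S B × ∣ B ∣ ≡ spanDim p d S) → solutions S * p ^ spanDim p d S ≡ p ^ d
      from-basis (B , independentIn@(_ , independent) , maximal) = begin
        solutions S * p ^ spanDim p d S   ≡⟨ cong₂ (λ s r → s * p ^ r) (solutions-basis independentIn maximal) (sym maximal) ⟩
        solutions B * p ^ ∣ B ∣           ≡⟨ proj₁ (independent⇒solutions ∣ B ∣ refl (Equivalence.to linIndep⇔independent independent)) ⟩
        p ^ d                             ∎
        where open ≡-Reasoning

  solutions≥1 : ∀ S → 1 ≤ solutions S
  solutions≥1 S = ListP.filter-some (solution? S) {xs = allFinVecs p d}
    (Any.map (λ { refl → zero-solution S }) (count≡1⇒∈ (VecP.≡-dec FinP._≟_) (allFinVecs p d)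
      (allVecs-enumerates FinP._≟_ (allFin p) (allFin-enumerates p) d ⌊ (λ _ → ℤ.0ℤ) ⌋)))

  spanDim≤d : ∀ S → spanDim p d S ≤ d
  spanDim≤d S with spanDim p d S ℕP.≤? d
  ... | yes r≤d = r≤d
  ... | no r≰d  = ⊥-elim (ℕP.<-irrefl refl (begin-strict
    p ^ d                            <⟨ ℕP.^-monoʳ-< p (ℕ.nonTrivial⇒n>1 p {{prime⇒nonTrivial prime}}) (ℕP.≰⇒> r≰d) ⟩
    p ^ spanDim p d S                ≤⟨ ℕP.m≤n*m (p ^ spanDim p d S) (solutions S) {{ℕ.>-nonZero (solutions≥1 S)}} ⟩
    solutions S * p ^ spanDim p d S  ≡⟨ rank-count S ⟩
    p ^ d                            ∎))
    where open ℕP.≤-Reasoning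

  spanDim≥1 : ∀ {S c} → c ∈ S → 1 ≤ spanDim p d S
  spanDim≥1 {S} {c} c∈S with col-nonzero d c
  ... | k , cₖ≡1 = subst (_≤ spanDim p d S) (∣⁅x⁆∣≡1 c)
    (spanDim-upper (λ x∈⁅c⁆ → subst (_∈ S) (sym (x∈⁅y⁆⇒x≡y c x∈⁅c⁆)) c∈S)
                   (Equivalence.from linIndep⇔independent (independent-⁅⁆ cₖ≡1)))

  solutions≡p^[d∸spanDim] : ∀ S → solutions S ≡ p ^ (d ∸ spanDim p d S)
  solutions≡p^[d∸spanDim] S = ℕP.*-cancelʳ-≡ (solutions S) (p ^ (d ∸ r)) (p ^ r) {{ℕP.m^n≢0 p r}} (begin
    solutions S * p ^ r     ≡⟨ rank-count S ⟩
    p ^ d                   ≡⟨ cong (p ^_) (ℕP.m∸n+n≡m (spanDim≤d S)) ⟨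
    p ^ (d ∸ r + r)         ≡⟨ ℕP.^-distribˡ-+-* p (d ∸ r) r ⟩
    p ^ (d ∸ r) * p ^ r     ∎)
    where
      open ≡-Reasoning
      r = spanDim p d S

module IntegerSums where

  open Counting using (allFin-enumerates)
  open import Data.Nat using (ℕ; zero; suc; _∸_; _<_; _≤_; z≤n; s≤s)
  import Data.Nat.Properties as ℕP
  open import Data.Integer using (ℤ; +_; _+_; _*_; 0ℤ; 1ℤ)
  import Data.Integer.Properties as ℤP
  open import Data.Fin using (Fin; toℕ; fromℕ<)
  import Data.Fin.Properties as FinP
  open import Data.List using (List; []; _∷_; map; allFin; upTo; applyUpTo; tabulate)
  import Data.List.Properties as ListP
  open import Function using (_∘_; id)
  open import Relation.Nullary using (Dec; yes; no)
  open import Relation.Unary using (Decidable)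
  open import Relation.Binary.PropositionalEquality
  open ListSum ℤP.+-*-commutativeSemiring

  ∑-pick-allFin : ∀ {m} {P : Fin m → Set} (P? : ∀ i → Dec (P i)) i₀ → (∀ {i} → P i → i ≡ i₀) → P i₀ →
                  (g : Fin m → ℤ) → ∑[ i ∈ allFin m ] (𝟙 (P? i) * g i) ≡ g i₀
  ∑-pick-allFin {m} P? i₀ P⇒≡ Pi₀ g = trans
    (∑-cong (allFin m) (λ i → cong (_* g i) (𝟙-cong (P? i) (i FinP.≟ i₀) P⇒≡ (λ { refl → Pi₀ }))))
    (∑-pick FinP._≟_ (allFin m) i₀ (allFin-enumerates m i₀) g)

  applyUpTo≡tabulate : ∀ (f : ℕ → ℕ) n → applyUpTo f n ≡ tabulate {n = n} (f ∘ toℕ)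
  applyUpTo≡tabulate f zero    = refl
  applyUpTo≡tabulate f (suc n) = cong (f 0 ∷_) (applyUpTo≡tabulate (f ∘ suc) n)

  upTo≡map-allFin : ∀ n → map suc (upTo n) ≡ map (suc ∘ toℕ) (allFin n)
  upTo≡map-allFin n = trans (ListP.map-applyUpTo id suc n)
    (trans (applyUpTo≡tabulate suc n) (sym (ListP.map-tabulate {n = n} id (suc ∘ toℕ))))

  ∑-oneTo : ∀ n (g : ℕ → ℤ) → ∑[ j ∈ map suc (upTo n) ] g j ≡ ∑[ i ∈ allFin n ] g (suc (toℕ i))
  ∑-oneTo n g = trans (cong (λ js → ∑ js g) (upTo≡map-allFin n)) (∑-map (allFin n) (suc ∘ toℕ) g)

  ∑-pick-oneTo : ∀ n {s} → 1 ≤ s → s ≤ n → (g : ℕ → ℤ) → ∑[ j ∈ map suc (upTo n) ] (𝟙 (s ℕP.≟ j) * g j) ≡ g s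
  ∑-pick-oneTo n {suc s} (s≤s z≤n) 1+s≤n g = trans (∑-oneTo n _)
    (trans (∑-pick-allFin (λ i → suc s ℕP.≟ suc (toℕ i)) i₀
              (λ {i} 1+s≡1+i → FinP.toℕ-injective (trans (sym (ℕP.suc-injective 1+s≡1+i)) (sym (FinP.toℕ-fromℕ< 1+s≤n))))
              (cong suc (sym (FinP.toℕ-fromℕ< 1+s≤n))) (g ∘ suc ∘ toℕ))
           (cong (g ∘ suc) (FinP.toℕ-fromℕ< 1+s≤n)))
    where i₀ = fromℕ< 1+s≤n

  ∑-pick-oneTo-zero : ∀ n (g : ℕ → ℤ) → ∑[ j ∈ map suc (upTo n) ] (𝟙 (0 ℕP.≟ j) * g j) ≡ 0ℤ
  ∑-pick-oneTo-zero n g = trans (∑-map (upTo n) suc _) (∑-zero (upTo n))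

  ∑-pick-complement : ∀ d {r} → 1 ≤ r → r ≤ d → (h : ℕ → ℤ) →
                      ∑[ i ∈ allFin d ] (𝟙 (r ℕP.≟ d ∸ toℕ i) * h (toℕ i)) ≡ h (d ∸ r)
  ∑-pick-complement d {r} 1≤r r≤d h = trans
    (∑-pick-allFin (λ i → r ℕP.≟ d ∸ toℕ i) i₀
      (λ {i} r≡d∸i → FinP.toℕ-injective (trans (sym (ℕP.m∸[m∸n]≡n (ℕP.<⇒≤ (FinP.toℕ<n i))))
                                                (trans (cong (d ∸_) (sym r≡d∸i)) (sym (FinP.toℕ-fromℕ< d∸r<d)))))
      (trans (sym (ℕP.m∸[m∸n]≡n r≤d)) (cong (d ∸_) (sym (FinP.toℕ-fromℕ< d∸r<d)))) (h ∘ toℕ))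
    (cong h (FinP.toℕ-fromℕ< d∸r<d))
    where
      d∸r<d : d ∸ r < d
      d∸r<d = ℕP.∸-monoʳ-< 1≤r r≤d
      i₀ = fromℕ< d∸r<d

  +count≡∑𝟙 : ∀ {A : Set} {P : A → Set} (P? : Decidable P) xs → + count P? xs ≡ ∑[ x ∈ xs ] 𝟙 (P? x)
  +count≡∑𝟙 P? []       = refl
  +count≡∑𝟙 P? (x ∷ xs) with P? x
  ... | yes _ = trans (ℤP.pos-+ 1 (count P? xs)) (cong (λ e → 1ℤ + e) (+count≡∑𝟙 P? xs))
  ... | no _  = trans (+count≡∑𝟙 P? xs) (sym (ℤP.+-identityˡ _))

module AlphaFormula {p : ℕ} (prime : Prime p) (d : ℕ) where

  open Counting using (count-cong; allSubsets-enumerates)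
  open InclusionExclusion using (NoneHolds; noneHolds?; inclusion-exclusion)
  open SubsetProperties using (∣p∣≡0⇒x∉p; ∣p∣≡1+m⇒nonempty)
  open Columns using (bit; support; bit∘support; support-col-nonempty; col-of-nonempty)
  open IntegerSums
  open import Data.Nat as ℕ using (ℕ; zero; suc; _∸_; _≤_; z≤n; s≤s)
  import Data.Nat.Properties as ℕP
  open import Data.Nat.Primality using (Prime)
  open import Data.Integer as ℤ using (ℤ; +_; _+_; _*_; 0ℤ; 1ℤ; -1ℤ)
  import Data.Integer.Properties as ℤP
  open import Data.Integer.Tactic.RingSolver using (solve-∀)
  open import Data.Fin using (Fin; toℕ)
  open import Data.Fin.Subset using (Subset; ∣_∣; ⊥)
  open import Data.Fin.Subset.Properties using (∣⊥∣≡0; ∣p∣≤n; Empty-unique)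
  import Data.Vec.Properties as VecP
  import Data.Bool.Properties as BoolP
  open import Data.List using (map; allFin; upTo)
  open import Data.Product using (∃; _,_; proj₂)
  open import Data.Vec using () renaming (map to mapⱽ)
  open import Function using (_⇔_; mk⇔; Equivalence)
  open import Relation.Nullary using (Dec; ¬_)
  open import Relation.Nullary.Decidable using (_×-dec_)
  open import Relation.Unary using (Decidable)
  open import Relation.Binary.PropositionalEquality
  open import Data.Nat.Divisibility using (_∣_)
  open ListSum ℤP.+-*-commutativeSemiring

  open Rank prime d
  open SolutionCount prime d
  open Modulo p using (_≋_; ∣⇒≋0; ≋0⇒∣)

  zeroSumFree⇔noneOrthogonal : ∀ v → ZeroSumFree p d v ⇔ NoneHolds orthogonal? v
  zeroSumFree⇔noneOrthogonal v = mk⇔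
    (λ zeroSumFree c orthogonal → zeroSumFree (support (col d c)) (support-col-nonempty d c)
       (≋0⇒∣ (subst (_≋ 0ℤ) (sym (selSum-column (sym (bit∘support (suc (toℕ c)) d)) v)) orthogonal)))
    (λ none S nonempty → from-col none (col-of-nonempty d S nonempty))
    where
      from-col : ∀ {S} → NoneHolds orthogonal? v → ∃ (λ c → col d c ≡ mapⱽ bit S) → ¬ (p ∣ selSum S v)
      from-col none (c , col≡S) p∣sum = none c (subst (_≋ 0ℤ) (selSum-column col≡S v) (∣⇒≋0 p∣sum))

  α≡∑ : + α p d ≡ ∑[ T ∈ allSubsets n ] (-1ℤ ℤ.^ ∣ T ∣ * + solutions T)
  α≡∑ = trans (cong +_ (count-cong (zeroSumFree? p d) (noneHolds? orthogonal?)
                         (λ {v} → Equivalence.to (zeroSumFree⇔noneOrthogonal v))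
                         (λ {v} → Equivalence.from (zeroSumFree⇔noneOrthogonal v)) (allFinVecs p d)))
              (inclusion-exclusion n orthogonal? (allFinVecs p d))

  P : ℤ
  P = + p

  +-^ : ∀ k → + (p ℕ.^ k) ≡ P ℤ.^ k
  +-^ zero    = refl
  +-^ (suc k) = trans (ℤP.pos-* p (p ℕ.^ k)) (cong (P *_) (+-^ k))

  coefficient : Subset n → ℕ → ℤ
  coefficient T i = ∑[ j ∈ map suc (upTo n) ] (-1ℤ ℤ.^ j * 𝟙 ((∣ T ∣ ℕP.≟ j) ×-dec (spanDim p d T ℕP.≟ d ∸ i)))

  coefficient≡ : ∀ T i → coefficient T i ≡ ∑[ j ∈ map suc (upTo n) ] (𝟙 (∣ T ∣ ℕP.≟ j) * (-1ℤ ℤ.^ j * 𝟙 (spanDim p d T ℕP.≟ d ∸ i)))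
  coefficient≡ T i = ∑-cong (map suc (upTo n)) λ j →
    trans (cong (-1ℤ ℤ.^ j *_) (𝟙-× (∣ T ∣ ℕP.≟ j) (spanDim p d T ℕP.≟ d ∸ i))) (lemma (-1ℤ ℤ.^ j) (𝟙 (∣ T ∣ ℕP.≟ j)) (𝟙 (spanDim p d T ℕP.≟ d ∸ i)))
    where lemma : ∀ a b c → a * (b * c) ≡ b * (a * c)
          lemma = solve-∀

  coefficient-empty : ∀ {T} i → ∣ T ∣ ≡ 0 → coefficient T i ≡ 0ℤ
  coefficient-empty {T} i ∣T∣≡0 = trans (coefficient≡ T i)
    (trans (cong (λ s → ∑[ j ∈ map suc (upTo n) ] (𝟙 (s ℕP.≟ j) * (-1ℤ ℤ.^ j * 𝟙 (spanDim p d T ℕP.≟ d ∸ i)))) ∣T∣≡0)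
           (∑-pick-oneTo-zero n _))

  coefficient-nonempty : ∀ {T s} i → ∣ T ∣ ≡ suc s → coefficient T i ≡ -1ℤ ℤ.^ suc s * 𝟙 (spanDim p d T ℕP.≟ d ∸ i)
  coefficient-nonempty {T} {s} i ∣T∣≡1+s = trans (coefficient≡ T i)
    (trans (cong (λ s → ∑[ j ∈ map suc (upTo n) ] (𝟙 (s ℕP.≟ j) * (-1ℤ ℤ.^ j * 𝟙 (spanDim p d T ℕP.≟ d ∸ i)))) ∣T∣≡1+s)
           (∑-pick-oneTo n (s≤s z≤n) (subst (_≤ n) ∣T∣≡1+s (∣p∣≤n T)) _))

  term-expansion : ∀ T → -1ℤ ℤ.^ ∣ T ∣ * + solutions T
                       ≡ 𝟙 (∣ T ∣ ℕP.≟ 0) * P ℤ.^ d + ∑[ i ∈ allFin d ] (coefficient T (toℕ i) * P ℤ.^ toℕ i)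
  term-expansion T = expand ∣ T ∣ refl
    where
      open ≡-Reasoning
      expand : ∀ s → ∣ T ∣ ≡ s → -1ℤ ℤ.^ s * + solutions T
                                 ≡ 𝟙 (s ℕP.≟ 0) * P ℤ.^ d + ∑[ i ∈ allFin d ] (coefficient T (toℕ i) * P ℤ.^ toℕ i)
      expand zero ∣T∣≡0 = begin
        1ℤ * + solutions T                          ≡⟨ ℤP.*-identityˡ _ ⟩
        + solutions T                               ≡⟨ cong +_ (solutions-empty (∣p∣≡0⇒x∉p ∣T∣≡0)) ⟩
        + (p ℕ.^ d)                                 ≡⟨ +-^ d ⟩
        P ℤ.^ d                                     ≡⟨ ℤP.*-identityˡ _ ⟨
        1ℤ * P ℤ.^ d                                ≡⟨ ℤP.+-identityʳ _ ⟨
        1ℤ * P ℤ.^ d + 0ℤ                           ≡⟨ cong (λ e → 1ℤ * P ℤ.^ d + e) (∑-zero (allFin d)) ⟨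
        1ℤ * P ℤ.^ d + ∑[ i ∈ allFin d ] 0ℤ         ≡⟨ cong (λ e → 1ℤ * P ℤ.^ d + e) (∑-cong (allFin d) vanish) ⟨
        1ℤ * P ℤ.^ d + ∑[ i ∈ allFin d ] (coefficient T (toℕ i) * P ℤ.^ toℕ i) ∎
        where
          vanish : ∀ i → coefficient T (toℕ i) * P ℤ.^ toℕ i ≡ 0ℤ
          vanish i = trans (cong (_* P ℤ.^ toℕ i) (coefficient-empty {T} (toℕ i) ∣T∣≡0)) (ℤP.*-zeroˡ (P ℤ.^ toℕ i))
      expand (suc s) ∣T∣≡1+s = begin
        σ * + solutions T                                                    ≡⟨ cong (λ k → σ * + k) (solutions≡p^[d∸spanDim] T) ⟩
        σ * + (p ℕ.^ (d ∸ r))                                                ≡⟨ cong (σ *_) (+-^ (d ∸ r)) ⟩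
        σ * P ℤ.^ (d ∸ r)                                                    ≡⟨ ∑-pick-complement d (spanDim≥1 c∈T) (spanDim≤d T) (λ k → σ * P ℤ.^ k) ⟨
        ∑[ i ∈ allFin d ] (𝟙 (r ℕP.≟ d ∸ toℕ i) * (σ * P ℤ.^ toℕ i))       ≡⟨ ∑-cong (allFin d) (λ i → trans (lemma _ σ _) (cong (_* P ℤ.^ toℕ i) (sym (coefficient-nonempty {T} (toℕ i) ∣T∣≡1+s)))) ⟩
        ∑[ i ∈ allFin d ] (coefficient T (toℕ i) * P ℤ.^ toℕ i)             ≡⟨ ℤP.+-identityˡ _ ⟨
        0ℤ * P ℤ.^ d + ∑[ i ∈ allFin d ] (coefficient T (toℕ i) * P ℤ.^ toℕ i) ∎
        where
          σ = -1ℤ ℤ.^ suc s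
          r = spanDim p d T
          c∈T = proj₂ (∣p∣≡1+m⇒nonempty ∣T∣≡1+s)
          lemma : ∀ e σ q → e * (σ * q) ≡ σ * e * q
          lemma = solve-∀

  count-empty-subsets : count (λ T → ∣ T ∣ ℕP.≟ 0) (allSubsets n) ≡ 1
  count-empty-subsets = trans
    (count-cong (λ T → ∣ T ∣ ℕP.≟ 0) (λ T → VecP.≡-dec BoolP._≟_ T ⊥)
      (λ ∣T∣≡0 → Empty-unique (λ (x , x∈T) → ∣p∣≡0⇒x∉p ∣T∣≡0 x∈T)) (λ { refl → ∣⊥∣≡0 n }) (allSubsets n))
    (allSubsets-enumerates n ⊥)

  ∑-coefficient : ∀ i → ∑[ T ∈ allSubsets n ] coefficient T i ≡ altSum p d i
  ∑-coefficient i = begin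
    ∑[ T ∈ AS ] ∑[ j ∈ JS ] (-1ℤ ℤ.^ j * 𝟙 (R? T j))   ≡⟨ ∑-comm AS JS (λ T j → -1ℤ ℤ.^ j * 𝟙 (R? T j)) ⟩
    ∑[ j ∈ JS ] ∑[ T ∈ AS ] (-1ℤ ℤ.^ j * 𝟙 (R? T j))   ≡⟨ ∑-cong JS (λ j → *-distribˡ-∑ (-1ℤ ℤ.^ j) AS (λ T → 𝟙 (R? T j))) ⟨
    ∑[ j ∈ JS ] (-1ℤ ℤ.^ j * ∑[ T ∈ AS ] 𝟙 (R? T j))   ≡⟨ ∑-cong JS (λ j → cong (-1ℤ ℤ.^ j *_) (+count≡∑𝟙 (λ T → R? T j) AS)) ⟨
    altSum p d i                                        ∎
    where
      open ≡-Reasoning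
      AS = allSubsets n
      JS = map suc (upTo n)
      R? : ∀ T j → Dec _
      R? T j = (∣ T ∣ ℕP.≟ j) ×-dec (spanDim p d T ℕP.≟ d ∸ i)

  α-polynomial : + α p d ≡ monicEval d (λ i → altSum p d (toℕ i)) P
  α-polynomial = begin
    + α p d                                                                  ≡⟨ α≡∑ ⟩
    ∑[ T ∈ AS ] (-1ℤ ℤ.^ ∣ T ∣ * + solutions T)                              ≡⟨ ∑-cong AS term-expansion ⟩
    ∑[ T ∈ AS ] (𝟙 (∣ T ∣ ℕP.≟ 0) * P ℤ.^ d + ∑[ i ∈ allFin d ] C T i)      ≡⟨ ∑-distrib-+ AS _ _ ⟩
    ∑[ T ∈ AS ] (𝟙 (∣ T ∣ ℕP.≟ 0) * P ℤ.^ d) + ∑[ T ∈ AS ] ∑[ i ∈ allFin d ] C T i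
                                                                             ≡⟨ cong₂ _+_ leading (∑-comm AS (allFin d) C) ⟩
    P ℤ.^ d + ∑[ i ∈ allFin d ] ∑[ T ∈ AS ] C T i                            ≡⟨ cong (λ e → P ℤ.^ d + e) (∑-cong (allFin d) collect) ⟩
    P ℤ.^ d + ∑[ i ∈ allFin d ] (altSum p d (toℕ i) * P ℤ.^ toℕ i)          ∎
    where
      open ≡-Reasoning
      AS = allSubsets n
      C : Subset n → Fin d → ℤ
      C T i = coefficient T (toℕ i) * P ℤ.^ toℕ i
      leading : ∑[ T ∈ AS ] (𝟙 (∣ T ∣ ℕP.≟ 0) * P ℤ.^ d) ≡ P ℤ.^ d
      leading = begin
        ∑[ T ∈ AS ] (𝟙 (∣ T ∣ ℕP.≟ 0) * P ℤ.^ d)  ≡⟨ *-distribʳ-∑ (P ℤ.^ d) AS (λ T → 𝟙 (∣ T ∣ ℕP.≟ 0)) ⟨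
        ∑[ T ∈ AS ] 𝟙 (∣ T ∣ ℕP.≟ 0) * P ℤ.^ d    ≡⟨ cong (_* P ℤ.^ d) (+count≡∑𝟙 (λ T → ∣ T ∣ ℕP.≟ 0) AS) ⟨
        + count (λ T → ∣ T ∣ ℕP.≟ 0) AS * P ℤ.^ d ≡⟨ cong (λ k → + k * P ℤ.^ d) count-empty-subsets ⟩
        1ℤ * P ℤ.^ d                              ≡⟨ ℤP.*-identityˡ _ ⟩
        P ℤ.^ d                                   ∎
      collect : ∀ i → ∑[ T ∈ AS ] C T i ≡ altSum p d (toℕ i) * P ℤ.^ toℕ i
      collect i = trans (sym (*-distribʳ-∑ (P ℤ.^ toℕ i) AS (λ T → coefficient T (toℕ i))))
                        (cong (_* P ℤ.^ toℕ i) (∑-coefficient (toℕ i)))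

module CoefficientBounds where

  open Counting using (length-allVecs; ∑-const)
  open import Data.Bool using (false; true)
  open import Data.Nat as ℕ using (ℕ; zero; suc; _≤_; z≤n; _^_)
  import Data.Nat.Properties as ℕP
  open import Data.Integer as ℤ using (ℤ; +_; _+_; _*_; ∣_∣; -1ℤ)
  import Data.Integer.Properties as ℤP
  open import Data.List using (List; []; _∷_; map; upTo; length)
  import Data.List.Properties as ListP
  open import Function using (_∘_)
  open import Relation.Binary.PropositionalEquality
  module ℕΣ = ListSum ℕP.+-*-commutativeSemiring
  open ListSum ℤP.+-*-commutativeSemiring

  ∣∑∣≤∑∣∣ : ∀ {A : Set} (xs : List A) (f : A → ℤ) → ∣ ∑ xs f ∣ ≤ ℕΣ.∑ xs (∣_∣ ∘ f)
  ∣∑∣≤∑∣∣ []       f = z≤n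
  ∣∑∣≤∑∣∣ (x ∷ xs) f = ℕP.≤-trans (ℤP.∣i+j∣≤∣i∣+∣j∣ (f x) _) (ℕP.+-monoʳ-≤ ∣ f x ∣ (∣∑∣≤∑∣∣ xs f))

  ∑-mono-≤ : ∀ {A : Set} (xs : List A) {f g : A → ℕ} → (∀ x → f x ≤ g x) → ℕΣ.∑ xs f ≤ ℕΣ.∑ xs g
  ∑-mono-≤ []       f≤g = z≤n
  ∑-mono-≤ (x ∷ xs) f≤g = ℕP.+-mono-≤ (f≤g x) (∑-mono-≤ xs f≤g)

  ∣-1^j*x∣≡∣x∣ : ∀ j x → ∣ -1ℤ ℤ.^ j * x ∣ ≡ ∣ x ∣
  ∣-1^j*x∣≡∣x∣ zero    x = cong ∣_∣ (ℤP.*-identityˡ x)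
  ∣-1^j*x∣≡∣x∣ (suc j) x = trans (cong ∣_∣ (trans (ℤP.*-assoc -1ℤ (-1ℤ ℤ.^ j) x) (ℤP.-1*i≡-i (-1ℤ ℤ.^ j * x))))
                                 (trans (ℤP.∣-i∣≡∣i∣ (-1ℤ ℤ.^ j * x)) (∣-1^j*x∣≡∣x∣ j x))

  altSum-bound : ∀ p d i → ∣ altSum p d i ∣ ≤ ncols d ℕ.* 2 ^ ncols d
  altSum-bound p d i = ℕP.≤-trans (∣∑∣≤∑∣∣ JS _) (ℕP.≤-trans (∑-mono-≤ JS term-bound) (ℕP.≤-reflexive (begin
    ℕΣ.∑ JS (λ _ → 2 ^ n)      ≡⟨ ∑-const JS (2 ^ n) ⟩
    length JS ℕ.* 2 ^ n        ≡⟨ cong (ℕ._* 2 ^ n) (trans (ListP.length-map suc (upTo n)) (ListP.length-upTo n)) ⟩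
    n ℕ.* 2 ^ n                ∎)))
    where
      open ≡-Reasoning
      n = ncols d
      JS = map suc (upTo n)
      term-bound : ∀ j → ∣ -1ℤ ℤ.^ j * + m p d j i ∣ ≤ 2 ^ n
      term-bound j = ℕP.≤-trans (ℕP.≤-reflexive (∣-1^j*x∣≡∣x∣ j (+ m p d j i)))
                                (ℕP.≤-trans (ListP.length-filter _ (allSubsets n)) (ℕP.≤-reflexive (length-allVecs (false ∷ true ∷ []) n)))

module BaseExpansion {p : ℕ} (1<p : 1 < p) where

  open InclusionExclusion using (neg-∑)
  open import Data.Nat using (ℕ; suc; _<_)
  import Data.Nat.Properties as ℕP
  open import Data.Integer as ℤ using (ℤ; +_; _+_; _*_; _-_; -_; ∣_∣; 0ℤ; 1ℤ)
  import Data.Integer.Properties as ℤP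
  open import Data.Integer.Tactic.RingSolver using (solve-∀)
  import Data.Fin as Fin
  open Fin using (Fin; toℕ)
  open import Data.List using (map; allFin; tabulate)
  import Data.List.Properties as ListP
  open import Data.Product using (_×_; _,_; proj₁; proj₂)
  open import Data.Sum using (_⊎_; inj₁; inj₂)
  open import Data.Empty using (⊥-elim)
  open import Function using (_∘_)
  open import Relation.Binary.PropositionalEquality
  open ListSum ℤP.+-*-commutativeSemiring

  open Modulo p using (small-≋0⇒≡0; multiple≋0; ≋-reflexive; ≋-trans)

  private
    P = + p

  ∑-allFin-suc : ∀ k (e : Fin (suc k) → ℤ) →
                 ∑[ i ∈ allFin (suc k) ] (e i * P ℤ.^ toℕ i) ≡ e Fin.zero * 1ℤ + P * ∑[ i ∈ allFin k ] (e (Fin.suc i) * P ℤ.^ toℕ i)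
  ∑-allFin-suc k e = cong (λ x → e Fin.zero * 1ℤ + x) (begin
    ∑ (tabulate Fin.suc) (λ i → e i * P ℤ.^ toℕ i)          ≡⟨ cong (λ is → ∑ is (λ i → e i * P ℤ.^ toℕ i)) (ListP.map-tabulate {n = k} (λ i → i) Fin.suc) ⟨
    ∑ (map Fin.suc (allFin k)) (λ i → e i * P ℤ.^ toℕ i)     ≡⟨ ∑-map (allFin k) Fin.suc (λ i → e i * P ℤ.^ toℕ i) ⟩
    ∑[ i ∈ allFin k ] (e (Fin.suc i) * (P * P ℤ.^ toℕ i))  ≡⟨ ∑-cong (allFin k) (λ i → lemma (e (Fin.suc i)) P (P ℤ.^ toℕ i)) ⟩
    ∑[ i ∈ allFin k ] (P * (e (Fin.suc i) * P ℤ.^ toℕ i))  ≡⟨ *-distribˡ-∑ P (allFin k) _ ⟨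
    P * ∑[ i ∈ allFin k ] (e (Fin.suc i) * P ℤ.^ toℕ i)    ∎)
    where
      open ≡-Reasoning
      lemma : ∀ a b c → a * (b * c) ≡ b * (a * c)
      lemma = solve-∀

  small-digit : ∀ {e₀ R} → ∣ e₀ ∣ < p → e₀ * 1ℤ + P * R ≡ 0ℤ → e₀ ≡ 0ℤ × R ≡ 0ℤ
  small-digit {e₀} {R} small e₀+P*R≡0 = e₀≡0 , nonzero-factor (ℤP.i*j≡0⇒i≡0∨j≡0 P P*R≡0)
    where
      lemma : ∀ e r p → e ≡ (e * 1ℤ + p * r) + - r * p
      lemma = solve-∀
      e₀≡0 : e₀ ≡ 0ℤ
      e₀≡0 = small-≋0⇒≡0 small (≋-trans (≋-reflexive (trans (lemma e₀ R P) (trans (cong (_+ - R * P) e₀+P*R≡0) (ℤP.+-identityˡ _))))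
                                        (multiple≋0 (- R)))
      P*R≡0 : P * R ≡ 0ℤ
      P*R≡0 = trans (sym (ℤP.+-identityˡ (P * R))) (trans (cong (λ x → x * 1ℤ + P * R) (sym e₀≡0)) e₀+P*R≡0)
      nonzero-factor : P ≡ 0ℤ ⊎ R ≡ 0ℤ → R ≡ 0ℤ
      nonzero-factor (inj₁ P≡0) = ⊥-elim (ℕP.<⇒≢ (ℕP.<-trans ℕP.0<1+n 1<p) (sym (ℤP.+-injective P≡0)))
      nonzero-factor (inj₂ R≡0) = R≡0

  base-p-unique : ∀ k (e : Fin k → ℤ) → (∀ i → ∣ e i ∣ < p) → ∑[ i ∈ allFin k ] (e i * P ℤ.^ toℕ i) ≡ 0ℤ →
                  ∀ i → e i ≡ 0ℤ
  base-p-unique (suc k) e small sum≡0 = digit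
    where
      digits = small-digit (small Fin.zero) (trans (sym (∑-allFin-suc k e)) sum≡0)
      digit : ∀ i → e i ≡ 0ℤ
      digit Fin.zero    = proj₁ digits
      digit (Fin.suc i) = base-p-unique k (e ∘ Fin.suc) (small ∘ Fin.suc) (proj₂ digits) i

  monic-coefficients-unique : ∀ d (a b : Fin d → ℤ) → (∀ i → ∣ a i - b i ∣ < p) →
                              monicEval d a P ≡ monicEval d b P → ∀ i → a i ≡ b i
  monic-coefficients-unique d a b small a≡b i =
    ℤP.i-j≡0⇒i≡j (a i) (b i) (base-p-unique d (λ i → a i - b i) small difference≡0 i)
    where
      open ≡-Reasoning
      A = ∑[ i ∈ allFin d ] (a i * P ℤ.^ toℕ i)
      B = ∑[ i ∈ allFin d ] (b i * P ℤ.^ toℕ i)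
      difference≡0 : ∑[ i ∈ allFin d ] ((a i - b i) * P ℤ.^ toℕ i) ≡ 0ℤ
      difference≡0 = begin
        ∑[ i ∈ allFin d ] ((a i - b i) * P ℤ.^ toℕ i)            ≡⟨ ∑-cong (allFin d) (λ i → lemma (a i) (b i) (P ℤ.^ toℕ i)) ⟩
        ∑[ i ∈ allFin d ] (a i * P ℤ.^ toℕ i + - (b i * P ℤ.^ toℕ i)) ≡⟨ ∑-distrib-+ (allFin d) _ _ ⟩
        A + ∑[ i ∈ allFin d ] (- (b i * P ℤ.^ toℕ i))            ≡⟨ cong (λ x → A + x) (neg-∑ (allFin d) (λ i → b i * P ℤ.^ toℕ i)) ⟨
        A - B                                                    ≡⟨ lemma′ (P ℤ.^ d) A B ⟩
        (P ℤ.^ d + A) - (P ℤ.^ d + B)                            ≡⟨ cong (_- (P ℤ.^ d + B)) a≡b ⟩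
        (P ℤ.^ d + B) - (P ℤ.^ d + B)                            ≡⟨ ℤP.+-inverseʳ (P ℤ.^ d + B) ⟩
        0ℤ                                                       ∎
        where lemma : ∀ a b q → (a - b) * q ≡ a * q + - (b * q)
              lemma = solve-∀
              lemma′ : ∀ q a b → a - b ≡ (q + a) - (q + b)
              lemma′ = solve-∀

open import Data.Nat using (_≤_)
open import Data.Nat.Primality using (prime⇒nonTrivial)
open import Data.Fin using (Fin; toℕ)
open import Data.Integer using (ℤ; +_)
open import Data.Product using (∃)
open import Relation.Binary.PropositionalEquality using (_≡_)
import Data.Nat as ℕ
import Data.Nat.Properties as ℕP
import Data.Integer as ℤ
import Data.Integer.Properties as ℤP
import Data.Fin.Properties as FinP
open import Data.List using (foldr; map; allFin)
open import Data.List.Membership.Propositional.Properties using (∈-map⁺)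
open import Data.Product using (_,_)
open import Function using (_∘_)
open import Relation.Binary.PropositionalEquality using (sym; trans)
open Counting using (max-upper; count≡1⇒∈; allFin-enumerates)
open CoefficientBounds using (altSum-bound)
open BaseExpansion using (monic-coefficients-unique)

proposition3p2 : (d : ℕ) → 1 ≤ d → (a : Fin d → ℤ) →
    (∃ λ N → ∀ (p : ℕ) → Prime p → N < p → + α p d ≡ monicEval d a (+ p)) →
    ∃ λ M → ∀ (p : ℕ) → Prime p → M < p → ∀ (i : Fin d) → a i ≡ altSum p d (toℕ i)
proposition3p2 d _ a (N , agrees) = N ℕ.+ (A ℕ.+ K) , coefficients
  where
    A = foldr ℕ._⊔_ 0 (map (ℤ.∣_∣ ∘ a) (allFin d))
    K = ncols d ℕ.* 2 ℕ.^ ncols d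
    coefficients : ∀ p → Prime p → N ℕ.+ (A ℕ.+ K) < p → ∀ i → a i ≡ altSum p d (toℕ i)
    coefficients p p-prime M<p =
      monic-coefficients-unique 1<p d a (λ i → altSum p d (toℕ i)) small
        (trans (sym (agrees p p-prime (ℕP.≤-<-trans (ℕP.m≤m+n N _) M<p))) (AlphaFormula.α-polynomial p-prime d))
      where
        1<p = ℕ.nonTrivial⇒n>1 p {{prime⇒nonTrivial p-prime}}
        small : ∀ i → ℤ.∣ a i ℤ.- altSum p d (toℕ i) ∣ < p
        small i = ℕP.≤-<-trans (ℕP.≤-trans (ℤP.∣i-j∣≤∣i∣+∣j∣ (a i) _)
                                (ℕP.+-mono-≤ (max-upper (∈-map⁺ (ℤ.∣_∣ ∘ a) (count≡1⇒∈ FinP._≟_ (allFin d) (allFin-enumerates d i))))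
                                             (altSum-bound p d (toℕ i))))
                               (ℕP.≤-<-trans (ℕP.m≤n+m _ N) M<p)
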